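{- Let $F=(V+r,E)$ be a finite directed graph with root node $r\notin V$ that is a flame, and assume $\varrho_F(r)=0$. Let $m=\max_{v\in V}\varrho_F(v)$, assume $m\ge 1$, and let $V_i=\{v\in V:\varrho_F(v)\ge i\}$ for $i=1,\ldots,m$. Then $E$ can be partitioned into branchings $B_1,B_2,\ldots,B_m$ such that for every $i=1,\ldots,m$ the head-set of $B_i$ is $V_i$ and the spanning subgraph $(V+r,B_1\cup\cdots\cup B_i)$ is a flame.
   Context: For a directed graph $H$ with root $r$ and vertex $v\neq r$, $\lambda_H(r,v)$ denotes the maximum number of pairwise edge-disjoint directed paths from $r$ to $v$ in $H$, and $\varrho_H(v)$ the in-degree of $v$ in $H$. A rooted digraph $H=(V+r,E_H)$ is a flame if $\lambda_H(r,v)=\varrho_H(v)$ for every $v\in V$. A branching is a set $B$ of edges which, disregarding directions, contains no cycle, and such that every vertex is entered by at most one edge of $B$; its head-set is the set of vertices entered by an edge of $B$. -}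

module Defs where

open import Data.Nat using (ℕ; suc; _≤_)
open import Data.Nat.Properties using (_≤?_)
open import Data.Fin using (Fin; zero; toℕ) renaming (_≟_ to _≟ᶠ_)
open import Data.Bool using (Bool; true; _∧_)
open import Data.List using (List; []; _∷_; _++_; [_]; map; filter; length)
open import Data.List.Base using (allFin)
open import Data.List.Membership.Propositional using (_∈_)
open import Data.List.Relation.Unary.Unique.Propositional using (Unique)
open import Data.Product using (Σ; _×_; ∃; ∃-syntax)
open import Data.Sum using (_⊎_)
open import Data.Empty using (⊥)
open import Relation.Nullary using (¬_; Dec; yes; no)
open import Relation.Nullary.Decidable using (⌊_⌋)
open import Relation.Binary.PropositionalEquality using (_≡_)
open import Function.Bundles using (_⇔_)

-- A finite directed multigraph with root: vertex set V + r is Fin (suc n),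
-- the root r is 'zero', V consists of the other vertices.
-- Edges are Fin k, with tail and head maps (parallel edges allowed).
record RootedDigraph : Set where
  field
    n  : ℕ
    k  : ℕ
    tl : Fin k → Fin (suc n)
    hd : Fin k → Fin (suc n)

module _ (G : RootedDigraph) where
  open RootedDigraph G

  Vertex : Set
  Vertex = Fin (suc n)

  Edge : Set
  Edge = Fin k

  root : Vertex
  root = zero

  EdgeSet : Set
  EdgeSet = Edge → Bool

  allEdges : EdgeSet
  allEdges _ = true

  inDeg : EdgeSet → Vertex → ℕ
  inDeg S v = length (filter (λ e → S e ≡? true) (filter (λ e → hd e ≟ᶠ v) (allFin k)))
    where
      _≡?_ : (a b : Bool) → Dec (a ≡ b)
      _≡?_ = Data.Bool._≟_

  data Walk (S : EdgeSet) : Vertex → Vertex → List Edge → Set where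
    nil  : ∀ {x} → Walk S x x []
    cons : ∀ {x y e es} → S e ≡ true → tl e ≡ x → Walk S (hd e) y es → Walk S x y (e ∷ es)

  Path : EdgeSet → Vertex → Vertex → List Edge → Set
  Path S x y es = Walk S x y es × Unique (x ∷ map hd es)

  DisjointPaths : EdgeSet → Vertex → ℕ → Set
  DisjointPaths S v t =
    Σ (Fin t → List Edge) λ P →
      ((i : Fin t) → Path S root v (P i)) ×
      ((i j : Fin t) → ¬ i ≡ j → (e : Edge) → e ∈ P i → e ∈ P j → ⊥)

  LambdaIs : EdgeSet → Vertex → ℕ → Set
  LambdaIs S v ℓ = DisjointPaths S v ℓ × ((t : ℕ) → DisjointPaths S v t → t ≤ ℓ)

  IsFlame : EdgeSet → Set
  IsFlame S = (v : Vertex) → ¬ v ≡ root → LambdaIs S v (inDeg S v)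

  Joins : Edge → Vertex → Vertex → Set
  Joins e x z = (tl e ≡ x × hd e ≡ z) ⊎ (hd e ≡ x × tl e ≡ z)

  data UWalk (S : EdgeSet) : Vertex → List Vertex → List Edge → Set where
    nil  : ∀ {x} → UWalk S x [] []
    cons : ∀ {x z vs e es} → S e ≡ true → Joins e x z → UWalk S z vs es →
           UWalk S x (z ∷ vs) (e ∷ es)

  -- an (undirected) cycle in S: closed walk x, w1, …, wl, x with distinct
  -- edges and distinct vertices w1, …, wl, x (length ≥ 1; loops and pairs
  -- of parallel edges count as cycles)
  HasCycle : EdgeSet → Set
  HasCycle S = ∃[ x ] ∃[ ws ] ∃[ es ]
    (UWalk S x (ws ++ [ x ]) es × Unique (ws ++ [ x ]) × Unique es)

  IsBranching : EdgeSet → Set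
  IsBranching B = ¬ HasCycle B ×
    ((e₁ e₂ : Edge) → B e₁ ≡ true → B e₂ ≡ true → hd e₁ ≡ hd e₂ → e₁ ≡ e₂)

  InHeadSet : EdgeSet → Vertex → Set
  InHeadSet B v = ∃[ e ] (B e ≡ true × hd e ≡ v)

  -- partition of the edges into B_1, …, B_m given by a colouring c : E → Fin m
  -- (Fin index i stands for B_{i+1})
  classOf : {m : ℕ} → (Edge → Fin m) → Fin m → EdgeSet
  classOf c i e = ⌊ c e ≟ᶠ i ⌋

  upTo : {m : ℕ} → (Edge → Fin m) → Fin m → EdgeSet
  upTo c i e = ⌊ toℕ (c e) ≤? toℕ i ⌋

-- A rooted digraph is a flame iff ϱ(X) ≥ ϱ(w) whenever w ∈ X ⊆ V: one direction is immediate, the other is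
-- Menger's theorem, proved with augmenting paths for unit-capacity flows and the decomposition of a flow
-- into paths. The branchings are peeled off from the top. If all in-degrees are at most m + 1, there is a
-- branching B whose heads are exactly the vertices of in-degree m + 1 such that F ∖ B still satisfies this
-- cut condition; then F ∖ B has maximum in-degree m and the same levels V_1, …, V_m, so induction provides
-- B_1, …, B_m, and B_{m+1} = B. To build B, edges are added one at a time while keeping ϱ_{F∖B}(X) ≥ m for
-- every X ⊆ V that contains a vertex of in-degree m + 1. A new edge must enter a still uncovered such vertex
-- from a vertex that is not one; taking it inside a smallest X that contains an uncovered such vertex and has
-- ϱ_{F∖B}(X) ≤ m, submodularity of ϱ shows that the invariant survives. B is acyclic because the vertices can
-- be ranked increasingly along its edges.

module Submission where

open import Defs
open import Data.Nat using (ℕ; suc; _≤_)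
open import Data.Fin using (Fin; toℕ)
open import Data.Product using (_×_; ∃-syntax)
open import Relation.Nullary using (¬_)
open import Relation.Binary.PropositionalEquality using (_≡_)
open import Function.Bundles using (_⇔_)


module Counting where

  open import Data.Nat using (ℕ; zero; suc; _+_; _*_; _≤_; _<_; z≤n; s≤s)
  open import Data.Nat.Properties
    using (≤-refl; ≤-reflexive; ≤-trans; ≤-pred; <⇒≱; ≮⇒≥; m≤n⇒m≤1+n; +-mono-≤; +-mono-≤-<;
           +-identityʳ; *-identityˡ; *-distribˡ-+; _<?_; module ≤-Reasoning;
           +-*-semiring; +-commutativeSemigroup; *-commutativeSemigroup)
  open import Data.Bool using (Bool; true; false; _∧_; _∨_; not)
  open import Data.Bool.Properties using (∧-identityʳ; ∧-zeroʳ; ∧-comm; ∨-zeroʳ; ∧-commutativeMonoid)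
  open import Data.Fin using (Fin; zero; suc; _≟_)
  open import Data.List using (List; []; _∷_; length)
  open import Data.List.Membership.Propositional using (_∈_)
  open import Data.List.Relation.Unary.All using (All; []; _∷_)
  import Data.List.Relation.Unary.All as All
  import Data.List.Relation.Unary.All.Properties as Allᵖ
  open import Data.List.Relation.Unary.Any using (here; there)
  open import Data.List.Relation.Unary.Unique.Propositional using (Unique; []; _∷_)
  open import Data.Product using (_×_; _,_; ∃; uncurry; proj₁; proj₂)
  open import Function using (_∘_)
  open import Data.Sum using (_⊎_; inj₁; inj₂)
  import Data.Vec as Vec
  open import Data.Vec.Properties using (lookup∘tabulate)
  open import Data.Fin.Subset.Properties using (anySubset?)
  open import Relation.Nullary using (Dec; yes; no; ¬_; contradiction; _×-dec_)
  open import Relation.Nullary.Decidable using (⌊_⌋; isYes≗does; dec-true; dec-false; ⌊⌋-map′)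
  open import Relation.Binary.PropositionalEquality
  open import Algebra.Bundles using (CommutativeMonoid)
  open import Algebra.Properties.Semiring.Sum +-*-semiring using (sum; ∑-comm; ∑-distrib-+; sum-cong-≗; *-distribˡ-sum)
  open import Algebra.Properties.CommutativeSemigroup +-commutativeSemigroup using () renaming (interchange to +-interchange)
  open import Algebra.Properties.CommutativeSemigroup *-commutativeSemigroup using () renaming (x∙yz≈y∙xz to *-comm-middle)
  open import Algebra.Properties.CommutativeSemigroup (CommutativeMonoid.commutativeSemigroup ∧-commutativeMonoid)
    using () renaming (xy∙z≈xz∙y to ∧-swapʳ) public

  ⟦_⟧ : Bool → ℕ
  ⟦ true ⟧ = 1
  ⟦ false ⟧ = 0

  fromTrue : ∀ {a} {A : Set a} (a? : Dec A) → ⌊ a? ⌋ ≡ true → A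
  fromTrue (yes a) _ = a

  fromFalse : ∀ {a} {A : Set a} (a? : Dec A) → ⌊ a? ⌋ ≡ false → ¬ A
  fromFalse (no ¬a) _ = ¬a

  ∧-true : ∀ x {y} → x ∧ y ≡ true → x ≡ true × y ≡ true
  ∧-true true {true} _ = refl , refl

  not-true : ∀ {x} → not x ≡ true → x ≡ false
  not-true {false} _ = refl

  ⌊⌋-true : ∀ {a} {A : Set a} (a? : Dec A) → A → ⌊ a? ⌋ ≡ true
  ⌊⌋-true a? a = trans (isYes≗does a?) (dec-true a? a)

  ⌊⌋-false : ∀ {a} {A : Set a} (a? : Dec A) → ¬ A → ⌊ a? ⌋ ≡ false
  ⌊⌋-false a? ¬a = trans (isYes≗does a?) (dec-false a? ¬a)

  ≟-refl : ∀ {n} (i : Fin n) → ⌊ i ≟ i ⌋ ≡ true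
  ≟-refl i = ⌊⌋-true (i ≟ i) refl

  _⊆_ : ∀ {n} → (Fin n → Bool) → (Fin n → Bool) → Set
  p ⊆ q = ∀ i → p i ≡ true → q i ≡ true

  count : ∀ {n} → (Fin n → Bool) → ℕ
  count {zero} p = 0
  count {suc n} p = ⟦ p zero ⟧ + count (p ∘ suc)

  count≡sum : ∀ {n} (p : Fin n → Bool) → count p ≡ sum (⟦_⟧ ∘ p)
  count≡sum {zero} p = refl
  count≡sum {suc n} p = cong (⟦ p zero ⟧ +_) (count≡sum (p ∘ suc))

  count-cong : ∀ {n} {p q : Fin n → Bool} → (∀ i → p i ≡ q i) → count p ≡ count q
  count-cong {zero} p≗q = refl
  count-cong {suc n} p≗q = cong₂ _+_ (cong ⟦_⟧ (p≗q zero)) (count-cong (p≗q ∘ suc))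

  ⟦⟧-mono : ∀ {x y} → (x ≡ true → y ≡ true) → ⟦ x ⟧ ≤ ⟦ y ⟧
  ⟦⟧-mono {false} _ = z≤n
  ⟦⟧-mono {true} x⇒y rewrite x⇒y refl = ≤-refl

  count-mono : ∀ {n} {p q : Fin n → Bool} → p ⊆ q → count p ≤ count q
  count-mono {zero} p⊆q = z≤n
  count-mono {suc n} p⊆q = +-mono-≤ (⟦⟧-mono (p⊆q zero)) (count-mono (p⊆q ∘ suc))

  count-mono-< : ∀ {n} {p q : Fin n → Bool} (i : Fin n) → p ⊆ q → p i ≡ false → q i ≡ true → count p < count q
  count-mono-< zero p⊆q p0≡false q0≡true rewrite p0≡false | q0≡true =
    s≤s (count-mono (p⊆q ∘ suc))
  count-mono-< (suc i) p⊆q pi≡false qi≡true =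
    +-mono-≤-< (⟦⟧-mono (p⊆q zero)) (count-mono-< i (p⊆q ∘ suc) pi≡false qi≡true)

  count≤n : ∀ {n} (p : Fin n → Bool) → count p ≤ n
  count≤n {zero} p = z≤n
  count≤n {suc n} p with p zero
  ... | true = s≤s (count≤n (p ∘ suc))
  ... | false = m≤n⇒m≤1+n (count≤n (p ∘ suc))

  count-none : ∀ {n} {p : Fin n → Bool} → (∀ i → p i ≡ false) → count p ≡ 0
  count-none {zero} _ = refl
  count-none {suc n} none rewrite none zero = count-none (none ∘ suc)

  count-witness : ∀ {n} (p : Fin n → Bool) → 0 < count p → ∃ λ i → p i ≡ true
  count-witness {suc n} p 0<count with p zero in p0
  ... | true = zero , p0
  ... | false with count-witness (p ∘ suc) 0<count
  ... | i , pi = suc i , pi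

  ⟦∧⟧-split : ∀ x y → ⟦ x ⟧ ≡ ⟦ x ∧ y ⟧ + ⟦ x ∧ not y ⟧
  ⟦∧⟧-split true true = refl
  ⟦∧⟧-split true false = refl
  ⟦∧⟧-split false y = refl

  count-split : ∀ {n} (p q : Fin n → Bool) → count p ≡ count (λ i → p i ∧ q i) + count (λ i → p i ∧ not (q i))
  count-split {zero} p q = refl
  count-split {suc n} p q =
    trans (cong₂ _+_ (⟦∧⟧-split (p zero) (q zero)) (count-split (p ∘ suc) (q ∘ suc)))
          (+-interchange ⟦ p zero ∧ q zero ⟧ ⟦ p zero ∧ not (q zero) ⟧ _ _)

  ⌊≟⌋-sym : ∀ {n} (i j : Fin n) → ⌊ i ≟ j ⌋ ≡ ⌊ j ≟ i ⌋
  ⌊≟⌋-sym i j with i ≟ j | j ≟ i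
  ... | yes _ | yes _ = refl
  ... | no _ | no _ = refl
  ... | yes i≡j | no j≢i = contradiction (sym i≡j) j≢i
  ... | no i≢j | yes j≡i = contradiction (sym j≡i) i≢j

  count-single : ∀ {n} (p : Fin n → Bool) (a : Fin n) → count (λ i → p i ∧ ⌊ i ≟ a ⌋) ≡ ⟦ p a ⟧
  count-single {suc n} p zero =
    trans (cong₂ _+_ (cong ⟦_⟧ (∧-identityʳ (p zero))) (count-none (λ i → ∧-zeroʳ (p (suc i)))))
          (+-identityʳ ⟦ p zero ⟧)
  count-single {suc n} p (suc a) = begin
    ⟦ p zero ∧ false ⟧ + count (λ i → p (suc i) ∧ ⌊ suc i ≟ suc a ⌋)
      ≡⟨ cong₂ _+_ (cong ⟦_⟧ (∧-zeroʳ (p zero)))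
                   (count-cong (λ i → cong (p (suc i) ∧_) (⌊⌋-map′ _ _ (i ≟ a)))) ⟩
    count (λ i → p (suc i) ∧ ⌊ i ≟ a ⌋)  ≡⟨ count-single (p ∘ suc) a ⟩
    ⟦ p (suc a) ⟧                       ∎
    where open ≡-Reasoning

  insert : ∀ {n} → Fin n → (Fin n → Bool) → Fin n → Bool
  insert a p i = ⌊ i ≟ a ⌋ ∨ p i

  delete : ∀ {n} → Fin n → (Fin n → Bool) → Fin n → Bool
  delete a p i = p i ∧ not ⌊ i ≟ a ⌋

  count-remove : ∀ {n} (p : Fin n → Bool) (a : Fin n) → count p ≡ ⟦ p a ⟧ + count (delete a p)
  count-remove p a = trans (count-split p (λ i → ⌊ i ≟ a ⌋)) (cong (_+ count (delete a p)) (count-single p a))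

  count-+-mono : ∀ {n} {p q p′ q′ : Fin n → Bool} →
                 (∀ i → ⟦ p i ⟧ + ⟦ q i ⟧ ≤ ⟦ p′ i ⟧ + ⟦ q′ i ⟧) → count p + count q ≤ count p′ + count q′
  count-+-mono {zero} _ = z≤n
  count-+-mono {suc n} {p} {q} {p′} {q′} pointwise = begin
    (⟦ p zero ⟧ + count (p ∘ suc)) + (⟦ q zero ⟧ + count (q ∘ suc))
      ≡⟨ +-interchange ⟦ p zero ⟧ _ ⟦ q zero ⟧ _ ⟩
    (⟦ p zero ⟧ + ⟦ q zero ⟧) + (count (p ∘ suc) + count (q ∘ suc))
      ≤⟨ +-mono-≤ (pointwise zero) (count-+-mono (pointwise ∘ suc)) ⟩
    (⟦ p′ zero ⟧ + ⟦ q′ zero ⟧) + (count (p′ ∘ suc) + count (q′ ∘ suc))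
      ≡⟨ +-interchange ⟦ p′ zero ⟧ ⟦ q′ zero ⟧ _ _ ⟩
    (⟦ p′ zero ⟧ + count (p′ ∘ suc)) + (⟦ q′ zero ⟧ + count (q′ ∘ suc)) ∎
    where open ≤-Reasoning

  count-delete : ∀ {n} {p : Fin n → Bool} {a} (h : Fin n → Bool) → p a ≡ true →
                 count (λ i → p i ∧ h i) ≡ ⟦ h a ⟧ + count (λ i → delete a p i ∧ h i)
  count-delete {p = p} {a} h pa = begin
    count (λ i → p i ∧ h i)                             ≡⟨ count-remove (λ i → p i ∧ h i) a ⟩
    ⟦ p a ∧ h a ⟧ + count (λ i → (p i ∧ h i) ∧ not ⌊ i ≟ a ⌋)
      ≡⟨ cong₂ _+_ (cong (λ b → ⟦ b ∧ h a ⟧) pa) (count-cong (λ i → ∧-swapʳ (p i) (h i) _)) ⟩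
    ⟦ h a ⟧ + count (λ i → delete a p i ∧ h i)          ∎
    where open ≡-Reasoning

  delete-insert : ∀ {n} {p : Fin n → Bool} {a} → p a ≡ false → ∀ i → delete a (insert a p) i ≡ p i
  delete-insert {a = a} pa i with i ≟ a
  ... | yes refl = sym pa
  ... | no _ = ∧-identityʳ _

  count-insert : ∀ {n} {p : Fin n → Bool} {a} (h : Fin n → Bool) → p a ≡ false →
                 count (λ i → insert a p i ∧ h i) ≡ ⟦ h a ⟧ + count (λ i → p i ∧ h i)
  count-insert {a = a} h pa = trans (count-delete h (cong (_∨ _) (≟-refl a)))
    (cong (⟦ h a ⟧ +_) (count-cong (λ i → cong (_∧ h i) (delete-insert pa i))))

  insert⁻ : ∀ {n} {p : Fin n → Bool} {a i} → insert a p i ≡ true → i ≡ a ⊎ p i ≡ true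
  insert⁻ {a = a} {i} h with i ≟ a
  ... | yes i≡a = inj₁ i≡a
  ... | no _ = inj₂ h

  ⊆-insert : ∀ {n} {p : Fin n → Bool} {a} → p ⊆ insert a p
  ⊆-insert {a = a} i pi = trans (cong (⌊ i ≟ a ⌋ ∨_) pi) (∨-zeroʳ _)

  insert-≢ : ∀ {n} {p : Fin n → Bool} {a i} → i ≢ a → insert a p i ≡ p i
  insert-≢ {a = a} {i} i≢a rewrite ⌊⌋-false (i ≟ a) i≢a = refl

  delete-≢ : ∀ {n} {p : Fin n → Bool} {a i} → i ≢ a → delete a p i ≡ p i
  delete-≢ {p = p} {a} {i} i≢a rewrite ⌊⌋-false (i ≟ a) i≢a = ∧-identityʳ (p i)

  insert-⊆ : ∀ {n} {p q : Fin n → Bool} {a} → q a ≡ true → p ⊆ q → insert a p ⊆ q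
  insert-⊆ {a = a} qa p⊆q i h with i ≟ a
  ... | yes refl = qa
  ... | no _ = p⊆q i h

  delete-⊆ : ∀ {n} {p : Fin n → Bool} {a} → delete a p ⊆ p
  delete-⊆ {p = p} i h = proj₁ (∧-true (p i) h)

  count-scale : ∀ {n} (b : Bool) (p : Fin n → Bool) → ⟦ b ⟧ * count p ≡ count (λ i → b ∧ p i)
  count-scale true p = *-identityˡ (count p)
  count-scale {n} false p = sym (count-none {n} {λ _ → false} (λ _ → refl))

  count-fibres : ∀ {k n} (p : Fin k → Bool) (f : Fin k → Fin n) →
                 sum (λ w → count (λ e → p e ∧ ⌊ f e ≟ w ⌋)) ≡ count p
  count-fibres p f = begin
    sum (λ w → count (λ e → p e ∧ ⌊ f e ≟ w ⌋))    ≡⟨ sum-cong-≗ (λ w → count≡sum (λ e → p e ∧ ⌊ f e ≟ w ⌋)) ⟩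
    sum (λ w → sum (λ e → ⟦ p e ∧ ⌊ f e ≟ w ⌋ ⟧))  ≡⟨ ∑-comm (λ w e → ⟦ p e ∧ ⌊ f e ≟ w ⌋ ⟧) ⟩
    sum (λ e → sum (λ w → ⟦ p e ∧ ⌊ f e ≟ w ⌋ ⟧))  ≡⟨ sum-cong-≗ fibre ⟩
    sum (⟦_⟧ ∘ p)                                  ≡⟨ count≡sum p ⟨
    count p                                        ∎
    where
    open ≡-Reasoning
    fibre : ∀ e → sum (λ w → ⟦ p e ∧ ⌊ f e ≟ w ⌋ ⟧) ≡ ⟦ p e ⟧
    fibre e = begin
      sum (λ w → ⟦ p e ∧ ⌊ f e ≟ w ⌋ ⟧)  ≡⟨ count≡sum (λ w → p e ∧ ⌊ f e ≟ w ⌋) ⟨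
      count (λ w → p e ∧ ⌊ f e ≟ w ⌋)    ≡⟨ count-cong (λ w → cong (p e ∧_) (⌊≟⌋-sym (f e) w)) ⟩
      count (λ w → p e ∧ ⌊ w ≟ f e ⌋)    ≡⟨ count-single (λ _ → p e) (f e) ⟩
      ⟦ p e ⟧                            ∎

  sumOver : ∀ {n} → (Fin n → Bool) → (Fin n → ℕ) → ℕ
  sumOver X g = sum (λ w → ⟦ X w ⟧ * g w)

  sumOver-cong : ∀ {n} (X : Fin n → Bool) {f g : Fin n → ℕ} → (∀ w → f w ≡ g w) → sumOver X f ≡ sumOver X g
  sumOver-cong X f≗g = sum-cong-≗ (λ w → cong (⟦ X w ⟧ *_) (f≗g w))

  sumOver-+ : ∀ {n} (X : Fin n → Bool) (f g : Fin n → ℕ) → sumOver X (λ w → f w + g w) ≡ sumOver X f + sumOver X g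
  sumOver-+ X f g = trans (sum-cong-≗ (λ w → *-distribˡ-+ ⟦ X w ⟧ (f w) (g w)))
                          (∑-distrib-+ (λ w → ⟦ X w ⟧ * f w) (λ w → ⟦ X w ⟧ * g w))

  sumOver-count : ∀ {k n} (X : Fin n → Bool) (p : Fin k → Bool) (f : Fin k → Fin n) →
                  sumOver X (λ w → count (λ e → p e ∧ ⌊ f e ≟ w ⌋)) ≡ count (λ e → p e ∧ X (f e))
  sumOver-count X p f = begin
    sum (λ w → ⟦ X w ⟧ * count (λ e → p e ∧ ⌊ f e ≟ w ⌋))
      ≡⟨ sum-cong-≗ (λ w → trans (count-scale (X w) (λ e → p e ∧ ⌊ f e ≟ w ⌋)) (count-cong (reorder w))) ⟩
    sum (λ w → count (λ e → (p e ∧ X (f e)) ∧ ⌊ f e ≟ w ⌋))  ≡⟨ count-fibres _ f ⟩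
    count (λ e → p e ∧ X (f e))                             ∎
    where
    open ≡-Reasoning
    reorder : ∀ w e → (X w ∧ (p e ∧ ⌊ f e ≟ w ⌋)) ≡ ((p e ∧ X (f e)) ∧ ⌊ f e ≟ w ⌋)
    reorder w e with f e ≟ w
    ... | yes refl = trans (∧-comm (X (f e)) _) (∧-swapʳ (p e) true (X (f e)))
    ... | no _ = trans (cong (X w ∧_) (∧-zeroʳ (p e))) (trans (∧-zeroʳ (X w)) (sym (∧-zeroʳ _)))

  sumOver-point : ∀ {n} (X : Fin n → Bool) (a : Fin n) (j : ℕ) →
                  sumOver X (λ w → j * ⟦ ⌊ a ≟ w ⌋ ⟧) ≡ j * ⟦ X a ⟧
  sumOver-point X a j = begin
    sum (λ w → ⟦ X w ⟧ * (j * ⟦ ⌊ a ≟ w ⌋ ⟧))   ≡⟨ sum-cong-≗ (λ w → *-comm-middle ⟦ X w ⟧ j _) ⟩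
    sum (λ w → j * (⟦ X w ⟧ * ⟦ ⌊ a ≟ w ⌋ ⟧))   ≡⟨ *-distribˡ-sum j (λ w → ⟦ X w ⟧ * ⟦ ⌊ a ≟ w ⌋ ⟧) ⟨
    j * sum (λ w → ⟦ X w ⟧ * ⟦ ⌊ a ≟ w ⌋ ⟧)     ≡⟨ cong (j *_) (sum-cong-≗ (λ w → ⟦⟧-∧ (X w) _)) ⟩
    j * sum (λ w → ⟦ X w ∧ ⌊ a ≟ w ⌋ ⟧)         ≡⟨ cong (j *_) (count≡sum (λ w → X w ∧ ⌊ a ≟ w ⌋)) ⟨
    j * count (λ w → X w ∧ ⌊ a ≟ w ⌋)          ≡⟨ cong (j *_) (count-cong (λ w → cong (X w ∧_) (⌊≟⌋-sym a w))) ⟩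
    j * count (λ w → X w ∧ ⌊ w ≟ a ⌋)          ≡⟨ cong (j *_) (count-single X a) ⟩
    j * ⟦ X a ⟧                                ∎
    where
    open ≡-Reasoning
    ⟦⟧-∧ : ∀ x y → ⟦ x ⟧ * ⟦ y ⟧ ≡ ⟦ x ∧ y ⟧
    ⟦⟧-∧ true y = +-identityʳ ⟦ y ⟧
    ⟦⟧-∧ false y = refl

  module _ {n : ℕ} where

    open import Data.List.Membership.DecPropositional (_≟_ {n}) using (_∈?_)

    length≤count : ∀ {p : Fin n → Bool} {l} → Unique l → All (λ i → p i ≡ true) l → length l ≤ count p
    length≤count [] [] = z≤n
    length≤count {p} {x ∷ l} (x∉l ∷ unique) (px ∷ pl) = begin
      suc (length l)                               ≤⟨ s≤s (length≤count unique (All.zipWith (uncurry p∧≢x) (pl , x∉l))) ⟩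
      suc (count (delete x p))                     ≡⟨ cong (λ b → ⟦ b ⟧ + count (delete x p)) px ⟨
      ⟦ p x ⟧ + count (delete x p)                 ≡⟨ count-remove p x ⟨
      count p                                      ∎
      where
      open ≤-Reasoning
      p∧≢x : ∀ {i} → p i ≡ true → x ≢ i → (p i ∧ not ⌊ i ≟ x ⌋) ≡ true
      p∧≢x pi x≢i rewrite pi | ⌊⌋-false (_ ≟ x) (x≢i ∘ sym) = refl

    count-∈≤length : ∀ (l : List (Fin n)) → count (λ i → ⌊ i ∈? l ⌋) ≤ length l
    count-∈≤length [] = ≤-reflexive (count-none (λ i → ⌊⌋-false (i ∈? []) λ ()))
    count-∈≤length (y ∷ l) = begin
      count (λ i → ⌊ i ∈? y ∷ l ⌋)                             ≡⟨ count-remove _ y ⟩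
      ⟦ ⌊ y ∈? y ∷ l ⌋ ⟧ + count (delete y (λ i → ⌊ i ∈? y ∷ l ⌋))
        ≤⟨ +-mono-≤ (⟦⟧-mono (λ _ → refl)) (count-mono ∈l) ⟩
      suc (count (λ i → ⌊ i ∈? l ⌋))                          ≤⟨ s≤s (count-∈≤length l) ⟩
      suc (length l)                                          ∎
      where
      open ≤-Reasoning
      ∈l : delete y (λ i → ⌊ i ∈? y ∷ l ⌋) ⊆ (λ i → ⌊ i ∈? l ⌋)
      ∈l i h with fromTrue (i ∈? y ∷ l) (proj₁ (∧-true ⌊ i ∈? y ∷ l ⌋ h))
      ... | here i≡y = contradiction i≡y (fromFalse (i ≟ y) (not-true (proj₂ (∧-true ⌊ i ∈? y ∷ l ⌋ h))))
      ... | there i∈l = ⌊⌋-true (i ∈? l) i∈l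

    unique-⊆-length⇒⊇ : ∀ {xs ys : List (Fin n)} → Unique xs → (∀ {i} → i ∈ xs → i ∈ ys) →
                        length ys ≤ length xs → ∀ {i} → i ∈ ys → i ∈ xs
    unique-⊆-length⇒⊇ {xs} {ys} unique xs⊆ys ys≤xs {i} i∈ys with i ∈? xs
    ... | yes i∈xs = i∈xs
    ... | no i∉xs = contradiction ys≤xs (<⇒≱ (begin-strict
      length xs                   <⟨ length≤count (Allᵖ.¬Any⇒All¬ xs i∉xs ∷ unique)
                                                   (∈ys i∈ys ∷ All.tabulate (∈ys ∘ xs⊆ys)) ⟩
      count (λ j → ⌊ j ∈? ys ⌋)   ≤⟨ count-∈≤length ys ⟩
      length ys                   ∎))
      where
      open ≤-Reasoning
      ∈ys : ∀ {j} → j ∈ ys → ⌊ j ∈? ys ⌋ ≡ true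
      ∈ys {j} = ⌊⌋-true (j ∈? ys)

    unique-length≤ : ∀ {l : List (Fin n)} → Unique l → length l ≤ n
    unique-length≤ unique =
      ≤-trans (length≤count {p = λ _ → true} unique (All.tabulate (λ _ → refl))) (count≤n (λ _ → true))

  module _ {n p} (P : (Fin n → Bool) → Set p) (P? : ∀ X → Dec (P X))
           (P-cong : ∀ {X Y} → (∀ i → X i ≡ Y i) → P X → P Y) where

    private
      fromSubset : ∀ {X} → P X → P (Vec.lookup (Vec.tabulate X))
      fromSubset {X} = P-cong (sym ∘ lookup∘tabulate X)

      minimise : ∀ fuel T → count T ≤ fuel → P T → ∃ λ T′ → P T′ × ∀ Y → P Y → count T′ ≤ count Y
      minimise fuel T T≤fuel PT with anySubset? (λ Y → P? (Vec.lookup Y) ×-dec count (Vec.lookup Y) <? count T)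
      ... | no none = T , PT , λ Y PY → ≮⇒≥ λ Y<T →
            none (Vec.tabulate Y , fromSubset PY , subst (_< count T) (count-cong (sym ∘ lookup∘tabulate Y)) Y<T)
      ... | yes (Y , PY , Y<T) with fuel
      ...   | zero = contradiction (≤-trans Y<T T≤fuel) λ ()
      ...   | suc fuel′ = minimise fuel′ (Vec.lookup Y) (≤-pred (≤-trans Y<T T≤fuel)) PY

    none-or-minimal : (∀ X → ¬ P X) ⊎ (∃ λ T → P T × ∀ Y → P Y → count T ≤ count Y)
    none-or-minimal with anySubset? (P? ∘ Vec.lookup)
    ... | no none = inj₁ λ X PX → none (Vec.tabulate X , fromSubset PX)
    ... | yes (T , PT) = inj₂ (minimise n (Vec.lookup T) (count≤n _) PT)


module Digraph (G : RootedDigraph) where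

  open import Data.Nat using (ℕ; zero; suc; _+_; _≤_; _<_; z≤n)
  open import Data.Nat.Properties using (≤-trans; ≤ᵇ⇒≤; <⇒≢)
  open import Data.Bool using (Bool; true; false; _∧_; _∨_; not)
  import Data.Bool as Bool
  open import Data.Bool.Properties using (∧-comm)
  open import Data.Fin using (Fin; zero; suc; _≟_)
  open import Data.List using (filter; tabulate; length)
  open import Data.List.Membership.Propositional using (_∈_)
  open import Data.List.Relation.Unary.Any using (here; there)
  import Data.List.Relation.Unary.All.Properties as Allᵖ
  open import Data.List.Relation.Unary.Unique.Propositional.Properties using (tabulate⁺)
  open import Data.List.Properties using (length-tabulate)
  open import Data.Product using (_×_; _,_; proj₁; proj₂; ∃)
  open import Function using (_∘_)
  open import Function.Bundles using (_⇔_; mk⇔)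
  open import Relation.Nullary using (yes; no; ¬_; contradiction)
  open import Relation.Nullary.Decidable using (⌊_⌋)
  open import Relation.Unary using (Pred; Decidable)
  open import Relation.Binary.PropositionalEquality

  open Counting

  open RootedDigraph G

  V : Set
  V = Vertex G

  E : Set
  E = Edge G

  r : V
  r = root G

  VertexSet : Set
  VertexSet = V → Bool

  indeg : EdgeSet G → V → ℕ
  indeg S v = count (λ e → S e ∧ ⌊ hd e ≟ v ⌋)

  outdeg : EdgeSet G → V → ℕ
  outdeg S v = count (λ e → S e ∧ ⌊ tl e ≟ v ⌋)

  enters : VertexSet → E → Bool
  enters X e = X (hd e) ∧ not (X (tl e))

  leaves : VertexSet → E → Bool
  leaves X e = X (tl e) ∧ not (X (hd e))

  ϱ : EdgeSet G → VertexSet → ℕ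
  ϱ S X = count (λ e → S e ∧ enters X e)

  δ : EdgeSet G → VertexSet → ℕ
  δ S X = count (λ e → S e ∧ leaves X e)

  _∖_ : EdgeSet G → EdgeSet G → EdgeSet G
  (S ∖ B) e = S e ∧ not (B e)

  CutCondition : EdgeSet G → Set
  CutCondition S = ∀ (X : VertexSet) → X r ≡ false → ∀ w → X w ≡ true → indeg S w ≤ ϱ S X

  ∖-⊆ : ∀ {S B} → (S ∖ B) ⊆ S
  ∖-⊆ {S} e h = proj₁ (∧-true (S e) h)

  indeg-mono : ∀ {S S′} → S ⊆ S′ → ∀ v → indeg S v ≤ indeg S′ v
  indeg-mono {S} S⊆S′ v = count-mono {k} λ e h →
    let (Se , hd≡v) = ∧-true (S e) h in cong₂ _∧_ (S⊆S′ e Se) hd≡v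

  indeg-cong : ∀ {S S′} → S ≗ S′ → ∀ v → indeg S v ≡ indeg S′ v
  indeg-cong S≗S′ v = count-cong {k} λ e → cong (_∧ ⌊ hd e ≟ v ⌋) (S≗S′ e)

  ϱ-cong : ∀ {S S′} → S ≗ S′ → ∀ X → ϱ S X ≡ ϱ S′ X
  ϱ-cong S≗S′ X = count-cong {k} λ e → cong (_∧ enters X e) (S≗S′ e)

  cutCondition-cong : ∀ {S S′} → S ≗ S′ → CutCondition S → CutCondition S′
  cutCondition-cong S≗S′ cut X Xr w Xw = subst₂ _≤_ (indeg-cong S≗S′ w) (ϱ-cong S≗S′ X) (cut X Xr w Xw)

  inHeadSet-⇔ : ∀ {B B′} → B ≗ B′ → ∀ {v} → InHeadSet G B v ⇔ InHeadSet G B′ v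
  inHeadSet-⇔ B≗B′ = mk⇔ (λ (e , Be , hd≡) → e , trans (sym (B≗B′ e)) Be , hd≡)
                         (λ (e , B′e , hd≡) → e , trans (B≗B′ e) B′e , hd≡)

  length-filter-filter : ∀ {a p q} {A : Set a} {P : Pred A p} {Q : Pred A q} (P? : Decidable P) (Q? : Decidable Q)
                         {m} (f : Fin m → A) →
                         length (filter P? (filter Q? (tabulate f))) ≡ count (λ i → ⌊ Q? (f i) ⌋ ∧ ⌊ P? (f i) ⌋)
  length-filter-filter P? Q? {zero} f = refl
  length-filter-filter P? Q? {suc m} f with Q? (f zero)
  ... | no _ = length-filter-filter P? Q? (f ∘ suc)
  ... | yes _ with P? (f zero)
  ...   | yes _ = cong suc (length-filter-filter P? Q? (f ∘ suc))
  ...   | no _ = length-filter-filter P? Q? (f ∘ suc)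

  inDeg≡indeg : ∀ S v → inDeg G S v ≡ indeg S v
  inDeg≡indeg S v = trans (length-filter-filter (λ e → S e Bool.≟ true) (λ e → hd e ≟ v) (λ e → e))
    (count-cong (λ e → trans (cong (⌊ hd e ≟ v ⌋ ∧_) (⌊≟true⌋ (S e))) (∧-comm _ (S e))))
    where
    ⌊≟true⌋ : ∀ b → ⌊ b Bool.≟ true ⌋ ≡ b
    ⌊≟true⌋ true = refl
    ⌊≟true⌋ false = refl

  indeg-pos : ∀ {S e} → S e ≡ true → 0 < indeg S (hd e)
  indeg-pos {S} {e} Se = subst (_< indeg S (hd e)) (count-none {k} {λ _ → false} λ _ → refl)
    (count-mono-< e (λ _ ()) refl (cong₂ _∧_ Se (≟-refl (hd e))))

  no-edges : ∀ {S} → (∀ w → indeg S w ≡ 0) → ∀ e → S e ≡ false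
  no-edges {S} indeg≡0 e with S e in Se
  ... | false = refl
  ... | true = contradiction (indeg≡0 (hd e)) (<⇒≢ (indeg-pos Se) ∘ sym)

  submodular-pt : ∀ a b c d →
                  ⟦ (a ∧ c) ∧ not (b ∧ d) ⟧ + ⟦ (a ∨ c) ∧ not (b ∨ d) ⟧ ≤ ⟦ a ∧ not b ⟧ + ⟦ c ∧ not d ⟧
  submodular-pt true  true  true  true  = ≤ᵇ⇒≤ _ _ _
  submodular-pt true  true  true  false = ≤ᵇ⇒≤ _ _ _
  submodular-pt true  true  false true  = ≤ᵇ⇒≤ _ _ _
  submodular-pt true  true  false false = ≤ᵇ⇒≤ _ _ _
  submodular-pt true  false true  true  = ≤ᵇ⇒≤ _ _ _
  submodular-pt true  false true  false = ≤ᵇ⇒≤ _ _ _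
  submodular-pt true  false false true  = ≤ᵇ⇒≤ _ _ _
  submodular-pt true  false false false = ≤ᵇ⇒≤ _ _ _
  submodular-pt false true  true  true  = ≤ᵇ⇒≤ _ _ _
  submodular-pt false true  true  false = ≤ᵇ⇒≤ _ _ _
  submodular-pt false true  false true  = ≤ᵇ⇒≤ _ _ _
  submodular-pt false true  false false = ≤ᵇ⇒≤ _ _ _
  submodular-pt false false true  true  = ≤ᵇ⇒≤ _ _ _
  submodular-pt false false true  false = ≤ᵇ⇒≤ _ _ _
  submodular-pt false false false true  = ≤ᵇ⇒≤ _ _ _
  submodular-pt false false false false = ≤ᵇ⇒≤ _ _ _

  ϱ-submodular : ∀ D X Y → ϱ D (λ w → X w ∧ Y w) + ϱ D (λ w → X w ∨ Y w) ≤ ϱ D X + ϱ D Y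
  ϱ-submodular D X Y = count-+-mono {k} pointwise
    where
    pointwise : ∀ e → ⟦ D e ∧ enters (λ w → X w ∧ Y w) e ⟧ + ⟦ D e ∧ enters (λ w → X w ∨ Y w) e ⟧ ≤
                      ⟦ D e ∧ enters X e ⟧ + ⟦ D e ∧ enters Y e ⟧
    pointwise e with D e
    ... | true = submodular-pt (X (hd e)) (X (tl e)) (Y (hd e)) (Y (tl e))
    ... | false = z≤n

  walk-⊆ : ∀ {S x y es e} → Walk G S x y es → e ∈ es → S e ≡ true
  walk-⊆ (cons Se _ _) (here refl) = Se
  walk-⊆ (cons _ _ walk) (there e∈) = walk-⊆ walk e∈

  walk-mono : ∀ {S S′ x y es} → S ⊆ S′ → Walk G S x y es → Walk G S′ x y es
  walk-mono S⊆S′ nil = nil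
  walk-mono S⊆S′ (cons Se tl≡ walk) = cons (S⊆S′ _ Se) tl≡ (walk-mono S⊆S′ walk)

  disjointPaths-mono : ∀ {S S′ v t} → S ⊆ S′ → DisjointPaths G S v t → DisjointPaths G S′ v t
  disjointPaths-mono S⊆S′ (P , paths , disjoint) =
    P , (λ i → walk-mono S⊆S′ (proj₁ (paths i)) , proj₂ (paths i)) , disjoint

  walk-enters : ∀ {S x y es} (X : VertexSet) → Walk G S x y es → X x ≡ false → X y ≡ true →
                ∃ λ e → e ∈ es × S e ≡ true × enters X e ≡ true
  walk-enters X nil Xx Xy = contradiction (trans (sym Xx) Xy) λ ()
  walk-enters X (cons {e = e} Se refl walk) Xx Xy with X (hd e) in Xhd
  ... | true = e , here refl , Se , cong₂ _∧_ Xhd (cong not Xx)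
  ... | false with walk-enters X walk Xhd Xy
  ...   | e′ , e′∈ , Se′ , enters-e′ = e′ , there e′∈ , Se′ , enters-e′

  disjointPaths≤ϱ : ∀ {S v t} → DisjointPaths G S v t → ∀ (X : VertexSet) → X r ≡ false → X v ≡ true → t ≤ ϱ S X
  disjointPaths≤ϱ {S} {v} {t} (P , paths , disjoint) X Xr Xv = subst (_≤ ϱ S X) (length-tabulate crossing)
    (length≤count (tabulate⁺ crossing-injective) (Allᵖ.tabulate⁺ crossing-enters))
    where
    crosses : ∀ i → ∃ λ e → e ∈ P i × S e ≡ true × enters X e ≡ true
    crosses i = walk-enters X (proj₁ (paths i)) Xr Xv
    crossing : Fin t → E
    crossing = proj₁ ∘ crosses
    crossing-enters : ∀ i → (S (crossing i) ∧ enters X (crossing i)) ≡ true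
    crossing-enters i = let (_ , _ , Se , entering) = crosses i in cong₂ _∧_ Se entering
    crossing-injective : ∀ {i j} → crossing i ≡ crossing j → i ≡ j
    crossing-injective {i} {j} eq with i ≟ j
    ... | yes i≡j = i≡j
    ... | no i≢j = contradiction (subst (_∈ P j) (sym eq) (proj₁ (proj₂ (crosses j))))
                                 (disjoint i j i≢j (crossing i) (proj₁ (proj₂ (crosses i))))

  singleton : V → VertexSet
  singleton v w = ⌊ w ≟ v ⌋

  ϱ-singleton≤indeg : ∀ S v → ϱ S (singleton v) ≤ indeg S v
  ϱ-singleton≤indeg S v = count-mono {k} λ e Se∧enters →
    let (Se , enters-v) = ∧-true (S e) Se∧enters in cong₂ _∧_ Se (proj₁ (∧-true (singleton v (hd e)) enters-v))

  disjointPaths≤indeg : ∀ {S v t} → ¬ v ≡ r → DisjointPaths G S v t → t ≤ indeg S v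
  disjointPaths≤indeg {S} {v} v≢r paths =
    ≤-trans (disjointPaths≤ϱ paths (singleton v) (⌊⌋-false (r ≟ v) (v≢r ∘ sym)) (≟-refl v)) (ϱ-singleton≤indeg S v)

  flame⇒cutCondition : ∀ {S} → IsFlame G S → CutCondition S
  flame⇒cutCondition {S} flame X Xr w Xw = subst (_≤ ϱ S X) (inDeg≡indeg S w)
    (disjointPaths≤ϱ (proj₁ (flame w w≢r)) X Xr Xw)
    where
    w≢r : ¬ w ≡ r
    w≢r refl = contradiction (trans (sym Xr) Xw) λ ()


module Flow (G : RootedDigraph) where

  open import Data.Nat using (ℕ; _+_; _*_)
  open import Data.Nat.Properties using (+-cancelˡ-≡; +-assoc; +-commutativeSemigroup)
  open import Data.Nat.Tactic.RingSolver using (solve-∀)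
  open import Data.Bool using (true; false; _∧_)
  open import Data.Bool.Properties using (∧-assoc)
  open import Algebra.Properties.CommutativeSemigroup +-commutativeSemigroup using (x∙yz≈y∙xz)
  open import Data.Fin using (_≟_)
  open import Function.Bundles using (_⇔_; mk⇔; module Equivalence)
  open import Relation.Nullary.Decidable using (⌊_⌋)
  open import Relation.Binary.PropositionalEquality

  open Counting
  open Digraph G

  open RootedDigraph G

  token : V → V → ℕ
  token a w = ⟦ ⌊ a ≟ w ⌋ ⟧

  units : V → ℕ → V → ℕ
  units a j w = j * token a w

  _⊕_ : (V → ℕ) → (V → ℕ) → V → ℕ
  (A ⊕ B) w = A w + B w

  Balanced : EdgeSet G → (V → ℕ) → (V → ℕ) → Set
  Balanced D A B = ∀ w → indeg D w + A w ≡ outdeg D w + B w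

  indeg-insert : ∀ {D e} w → D e ≡ false → indeg (insert e D) w ≡ token (hd e) w + indeg D w
  indeg-insert w De = count-insert (λ e′ → ⌊ hd e′ ≟ w ⌋) De

  outdeg-insert : ∀ {D e} w → D e ≡ false → outdeg (insert e D) w ≡ token (tl e) w + outdeg D w
  outdeg-insert w De = count-insert (λ e′ → ⌊ tl e′ ≟ w ⌋) De

  indeg-delete : ∀ {D e} w → D e ≡ true → indeg D w ≡ token (hd e) w + indeg (delete e D) w
  indeg-delete w De = count-delete (λ e′ → ⌊ hd e′ ≟ w ⌋) De

  outdeg-delete : ∀ {D e} w → D e ≡ true → outdeg D w ≡ token (tl e) w + outdeg (delete e D) w
  outdeg-delete w De = count-delete (λ e′ → ⌊ tl e′ ≟ w ⌋) De

  -- Both sides of the second equation exceed those of the first by h.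
  move-token : ∀ i a o b h t → i + a ≡ o + (t + b) ⇔ (h + i) + a ≡ (t + o) + (h + b)
  move-token i a o b h t = mk⇔
    (λ eq → trans (+-assoc h i a) (trans (cong (h +_) eq) (rearrange i a o b h t)))
    (λ eq → +-cancelˡ-≡ h _ _ (trans (sym (+-assoc h i a)) (trans eq (sym (rearrange i a o b h t)))))
    where
    rearrange : ∀ i a o b h t → h + (o + (t + b)) ≡ (t + o) + (h + b)
    rearrange = solve-∀

  balanced-token : ∀ {D A B} x → Balanced D A B ⇔ Balanced D (token x ⊕ A) (token x ⊕ B)
  balanced-token {D} {A} {B} x = mk⇔
    (λ bal w → trans (swap-in w) (trans (cong (token x w +_) (bal w)) (sym (swap-out w))))
    (λ bal w → +-cancelˡ-≡ (token x w) _ _ (trans (sym (swap-in w)) (trans (bal w) (swap-out w))))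
    where
    swap-in : ∀ w → indeg D w + (token x w + A w) ≡ token x w + (indeg D w + A w)
    swap-in w = x∙yz≈y∙xz (indeg D w) (token x w) (A w)
    swap-out : ∀ w → outdeg D w + (token x w + B w) ≡ token x w + (outdeg D w + B w)
    swap-out w = x∙yz≈y∙xz (outdeg D w) (token x w) (B w)

  balanced-insert : ∀ {D A B e} → Balanced D A (token (tl e) ⊕ B) → D e ≡ false →
                    Balanced (insert e D) A (token (hd e) ⊕ B)
  balanced-insert {D} {A} {B} {e} bal De w =
    subst₂ (λ i o → i + A w ≡ o + (token (hd e) w + B w)) (sym (indeg-insert w De)) (sym (outdeg-insert w De))
      (Equivalence.to (move-token (indeg D w) (A w) (outdeg D w) (B w) (token (hd e) w) (token (tl e) w)) (bal w))

  balanced-delete : ∀ {D A B e} → Balanced D A (token (hd e) ⊕ B) → D e ≡ true →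
                    Balanced (delete e D) A (token (tl e) ⊕ B)
  balanced-delete {D} {A} {B} {e} bal De w =
    Equivalence.from (move-token (indeg (delete e D) w) (A w) (outdeg (delete e D) w) (B w) (token (hd e) w) (token (tl e) w))
      (subst₂ (λ i o → i + A w ≡ o + (token (hd e) w + B w)) (indeg-delete w De) (outdeg-delete w De) (bal w))

  balanced-cut : ∀ {D A B} → Balanced D A B → ∀ X → ϱ D X + sumOver X A ≡ δ D X + sumOver X B
  balanced-cut {D} {A} {B} bal X = +-cancelˡ-≡ inside _ _ (begin
    inside + (ϱ D X + sumOver X A)      ≡⟨ +-assoc inside _ _ ⟨
    (inside + ϱ D X) + sumOver X A      ≡⟨ cong (_+ sumOver X A) sumOver-indeg ⟨
    sumOver X (indeg D) + sumOver X A   ≡⟨ sumOver-+ X (indeg D) A ⟨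
    sumOver X (indeg D ⊕ A)             ≡⟨ sumOver-cong X bal ⟩
    sumOver X (outdeg D ⊕ B)            ≡⟨ sumOver-+ X (outdeg D) B ⟩
    sumOver X (outdeg D) + sumOver X B  ≡⟨ cong (_+ sumOver X B) sumOver-outdeg ⟩
    (inside + δ D X) + sumOver X B      ≡⟨ +-assoc inside _ _ ⟩
    inside + (δ D X + sumOver X B)      ∎)
    where
    open ≡-Reasoning
    inside = count (λ e → (D e ∧ X (hd e)) ∧ X (tl e))
    sumOver-indeg : sumOver X (indeg D) ≡ inside + ϱ D X
    sumOver-indeg = trans (sumOver-count X D hd) (trans (count-split (λ e → D e ∧ X (hd e)) (λ e → X (tl e)))
      (cong (inside +_) (count-cong (λ e → ∧-assoc (D e) _ _))))
    sumOver-outdeg : sumOver X (outdeg D) ≡ inside + δ D X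
    sumOver-outdeg = trans (sumOver-count X D tl) (trans (count-split (λ e → D e ∧ X (tl e)) (λ e → X (hd e)))
      (cong₂ _+_ (count-cong (λ e → ∧-swapʳ (D e) _ _)) (count-cong (λ e → ∧-assoc (D e) _ _))))


module Residual (G : RootedDigraph) where

  open import Data.Nat using (ℕ; zero; suc; _+_; _≤_; s≤s)
  open import Data.Nat.Properties using (+-suc; +-identityʳ; <⇒≱; ≤-refl)
  open import Data.Bool using (Bool; true; false; _∧_; not)
  open import Data.Bool.Properties using (∧-zeroʳ; ∧-inverseʳ)
  import Data.Bool as Bool
  open import Data.Fin using (_≟_)
  open import Data.Fin.Properties using (any?)
  open import Data.List using (List; []; _∷_; [_]; length; map)
  open import Data.List.Membership.Propositional using (_∈_; _∉_)
  open import Data.List.Membership.DecPropositional (_≟_ {n = suc (RootedDigraph.n G)}) using (_∈?_)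
  open import Data.List.Relation.Unary.Any using (here; there)
  open import Data.List.Relation.Unary.All using ([]; _∷_)
  import Data.List.Relation.Unary.All.Properties as Allᵖ
  open import Data.List.Relation.Unary.Unique.Propositional using (Unique; []; _∷_)
  open import Data.List.Relation.Binary.Subset.Propositional.Properties using (∷⁺ʳ)
  open import Data.Product using (_×_; _,_; proj₁; proj₂; ∃)
  open import Data.Sum using (_⊎_; inj₁; inj₂)
  import Data.Sum as Sum
  open import Function using (_∘_)
  open import Relation.Nullary using (Dec; yes; no; ¬_; contradiction; ¬?; _×-dec_; _⊎-dec_)
  open import Relation.Nullary.Decidable using (⌊_⌋)
  open import Relation.Binary.PropositionalEquality hiding ([_])

  open Counting
  open Digraph G
  open Flow G

  open RootedDigraph G

  data ResidualStep (S D : EdgeSet G) (e : E) : V → V → Set where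
    forward : (S ∖ D) e ≡ true → ResidualStep S D e (tl e) (hd e)
    backward : D e ≡ true → ResidualStep S D e (hd e) (tl e)

  data ResidualPath (S D : EdgeSet G) (s : V) : V → List V → Set where
    start : ResidualPath S D s s [ s ]
    step : ∀ {a b vs} (e : E) → ResidualPath S D s a vs → ResidualStep S D e a b → b ∉ vs →
           ResidualPath S D s b (b ∷ vs)

  Closed : EdgeSet G → EdgeSet G → VertexSet → Set
  Closed S D R = ∀ e → ((S ∖ D) e ≡ true → R (tl e) ≡ true → R (hd e) ≡ true) ×
                       (D e ≡ true → R (hd e) ≡ true → R (tl e) ≡ true)

  module Search (S D : EdgeSet G) (s t : V) where

    Result : Set
    Result = (∃ λ vs → ResidualPath S D s t vs) ⊎ (∃ λ R → R s ≡ true × R t ≡ false × Closed S D R)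

    Reached : List V → Set
    Reached Rs = ∀ {w} → w ∈ Rs → ∃ λ vs → ResidualPath S D s w vs × (∀ {u} → u ∈ vs → u ∈ Rs)

    Escapes : List V → E → Set
    Escapes Rs e = ((S ∖ D) e ≡ true × tl e ∈ Rs × hd e ∉ Rs) ⊎ (D e ≡ true × hd e ∈ Rs × tl e ∉ Rs)

    escapes? : ∀ Rs e → Dec (Escapes Rs e)
    escapes? Rs e = ((S ∖ D) e Bool.≟ true ×-dec tl e ∈? Rs ×-dec ¬? (hd e ∈? Rs))
              ⊎-dec (D e Bool.≟ true ×-dec hd e ∈? Rs ×-dec ¬? (tl e ∈? Rs))

    extend : ∀ {Rs e} → Reached Rs → Escapes Rs e → ∃ λ b → b ∉ Rs × Reached (b ∷ Rs)
    extend {Rs} {e} reached (inj₁ (f , a∈ , b∉)) = hd e , b∉ , reached′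
      where
      reached′ : Reached (hd e ∷ Rs)
      reached′ (here refl) with reached a∈
      ... | vs , p , vs⊆ = hd e ∷ vs , step e p (forward f) (b∉ ∘ vs⊆) , ∷⁺ʳ _ vs⊆
      reached′ (there w∈) = let (vs , p , vs⊆) = reached w∈ in vs , p , there ∘ vs⊆
    extend {Rs} {e} reached (inj₂ (d , a∈ , b∉)) = tl e , b∉ , reached′
      where
      reached′ : Reached (tl e ∷ Rs)
      reached′ (here refl) with reached a∈
      ... | vs , p , vs⊆ = tl e ∷ vs , step e p (backward d) (b∉ ∘ vs⊆) , ∷⁺ʳ _ vs⊆
      reached′ (there w∈) = let (vs , p , vs⊆) = reached w∈ in vs , p , there ∘ vs⊆

    closed : ∀ {Rs} → (∀ e → ¬ Escapes Rs e) → Closed S D (λ w → ⌊ w ∈? Rs ⌋)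
    closed {Rs} stuck e = forward-closed , backward-closed
      where
      forward-closed : (S ∖ D) e ≡ true → ⌊ tl e ∈? Rs ⌋ ≡ true → ⌊ hd e ∈? Rs ⌋ ≡ true
      forward-closed f a∈ with hd e ∈? Rs
      ... | yes _ = refl
      ... | no b∉ = contradiction (inj₁ (f , fromTrue (tl e ∈? Rs) a∈ , b∉)) (stuck e)
      backward-closed : D e ≡ true → ⌊ hd e ∈? Rs ⌋ ≡ true → ⌊ tl e ∈? Rs ⌋ ≡ true
      backward-closed d a∈ with tl e ∈? Rs
      ... | yes _ = refl
      ... | no b∉ = contradiction (inj₂ (d , fromTrue (hd e ∈? Rs) a∈ , b∉)) (stuck e)

    -- Each round adds a new vertex, so n + 1 rounds suffice.
    loop : ∀ (fuel : ℕ) Rs → Unique Rs → s ∈ Rs → Reached Rs → suc n ≤ length Rs + fuel → Result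
    loop fuel Rs unique s∈ reached enough with t ∈? Rs
    ... | yes t∈ = let (vs , p , _) = reached t∈ in inj₁ (vs , p)
    ... | no t∉ with any? (escapes? Rs)
    ...   | no none = inj₂ ((λ w → ⌊ w ∈? Rs ⌋) , ⌊⌋-true (s ∈? Rs) s∈ , ⌊⌋-false (t ∈? Rs) t∉ ,
                            closed (λ e esc → none (e , esc)))
    ...   | yes (e , esc) with extend reached esc | fuel
    ...     | b , b∉ , reached′ | zero = contradiction (unique-length≤ (Allᵖ.¬Any⇒All¬ Rs b∉ ∷ unique))
                                                       (<⇒≱ (s≤s (subst (suc n ≤_) (+-identityʳ (length Rs)) enough)))
    ...     | b , b∉ , reached′ | suc fuel′ = loop fuel′ (b ∷ Rs) (Allᵖ.¬Any⇒All¬ Rs b∉ ∷ unique) (there s∈) reached′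
                                                (subst (suc n ≤_) (+-suc (length Rs) fuel′) enough)

    search : Result
    search = loop n [ s ] ([] ∷ []) (here refl) reached ≤-refl
      where
      reached : Reached [ s ]
      reached (here refl) = [ s ] , start , λ u∈ → u∈

  edges : ∀ {S D s b vs} → ResidualPath S D s b vs → List E
  edges start = []
  edges (step e p _ _) = e ∷ edges p

  head∈ : ∀ {S D s b vs} → ResidualPath S D s b vs → b ∈ vs
  head∈ start = here refl
  head∈ (step _ _ _ _) = here refl

  step-endpoints : ∀ {S D e a b vs} → ResidualStep S D e a b → a ∈ vs → hd e ∈ b ∷ vs × tl e ∈ b ∷ vs
  step-endpoints (forward _) a∈ = here refl , there a∈
  step-endpoints (backward _) a∈ = there a∈ , here refl

  edges-endpoints : ∀ {S D s b vs e} (p : ResidualPath S D s b vs) → e ∈ edges p → hd e ∈ vs × tl e ∈ vs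
  edges-endpoints (step _ p st _) (here refl) = step-endpoints st (head∈ p)
  edges-endpoints (step _ p _ _) (there e∈) = let (hd∈ , tl∈) = edges-endpoints p e∈ in there hd∈ , there tl∈

  Outside : E → List V → Set
  Outside e vs = hd e ∉ vs ⊎ tl e ∉ vs

  outside⇒≢ : ∀ {e e′ vs} → Outside e′ vs → hd e ∈ vs × tl e ∈ vs → e′ ≢ e
  outside⇒≢ (inj₁ hd∉) (hd∈ , _) refl = hd∉ hd∈
  outside⇒≢ (inj₂ tl∉) (_ , tl∈) refl = tl∉ tl∈

  record Augmented (S D : EdgeSet G) (A B : V → ℕ) (b : V) (vs : List V) (es : List E) : Set where
    field
      D′ : EdgeSet G
      balanced : Balanced D′ A (token b ⊕ B)
      D′⊆S : D′ ⊆ S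
      flipped : ∀ {e} → e ∈ es → D′ e ≡ not (D e)
      agrees : ∀ e → Outside e vs → D′ e ≡ D e

  -- Pushing one more unit from s along p moves the surplus token from s to the end of p.
  augment : ∀ {S D A B s b vs} → D ⊆ S → Balanced D A (token s ⊕ B) → (p : ResidualPath S D s b vs) →
            Augmented S D A B b vs (edges p)
  augment D⊆S bal start = record { D′ = _ ; balanced = bal ; D′⊆S = D⊆S ; flipped = λ () ; agrees = λ _ _ → refl }
  augment {S} {D} {A} {B} D⊆S bal (step {a} {b} {vs} e p st b∉) = augment-step st
    where
    open Augmented (augment D⊆S bal p) renaming (D′ to D″; balanced to balanced″; D′⊆S to D″⊆S)
    outside : ∀ {e} → ResidualStep S D e a b → Outside e vs
    outside (forward _) = inj₁ b∉
    outside (backward _) = inj₂ b∉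
    e-outside : Outside e vs
    e-outside = outside st
    D″e≡De : D″ e ≡ D e
    D″e≡De = agrees e e-outside
    finish : (D‴ : EdgeSet G) → Balanced D‴ A (token b ⊕ B) → D‴ ⊆ S → D‴ e ≡ not (D e) →
             (∀ {e′} → e′ ≢ e → D‴ e′ ≡ D″ e′) → Augmented S D A B b (b ∷ vs) (e ∷ edges p)
    finish D‴ balanced‴ D‴⊆S flipped-e untouched = record
      { D′ = D‴ ; balanced = balanced‴ ; D′⊆S = D‴⊆S
      ; flipped = λ { (here refl) → flipped-e
                    ; (there e′∈) → trans (untouched (outside⇒≢ e-outside (edges-endpoints p e′∈) ∘ sym)) (flipped e′∈) }
      ; agrees = λ e′ out → trans (untouched (outside⇒≢ out (step-endpoints st (head∈ p))))
                                  (agrees e′ (Sum.map (_∘ there) (_∘ there) out)) }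
    augment-step : ResidualStep S D e a b → Augmented S D A B b (b ∷ vs) (e ∷ edges p)
    augment-step (forward residual) = finish (insert e D″)
      (balanced-insert balanced″ (trans D″e≡De De≡false)) (insert-⊆ {p = D″} Se D″⊆S)
      (trans (cong (Bool._∨ D″ e) (≟-refl e)) (sym (cong not De≡false))) (insert-≢ {p = D″})
      where
      Se = ∖-⊆ {S} {D} e residual
      De≡false = not-true (proj₂ (∧-true (S e) residual))
    augment-step (backward De) = finish (delete e D″)
      (balanced-delete balanced″ (trans D″e≡De De)) (λ e′ → D″⊆S e′ ∘ delete-⊆ {p = D″} e′)
      (trans (cong (λ x → D″ e ∧ not x) (≟-refl e)) (trans (∧-zeroʳ (D″ e)) (sym (cong not De)))) (delete-≢ {p = D″})

  backward-path : ∀ {D s b vs} (p : ResidualPath D D s b vs) →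
                  Path G D b s (edges p) × (∀ {u} → u ∈ b ∷ map hd (edges p) → u ∈ vs)
  backward-path start = (nil , [] ∷ []) , λ u∈ → u∈
  backward-path {D} (step e p (forward De∧¬De) b∉) = contradiction (trans (sym (∧-inverseʳ (D e))) De∧¬De) λ ()
  backward-path (step e p (backward De) b∉) with backward-path p
  ... | (walk , unique) , ⊆vs = (cons De refl walk , Allᵖ.¬Any⇒All¬ _ (b∉ ∘ ⊆vs) ∷ unique) , ∷⁺ʳ _ ⊆vs


module Menger (G : RootedDigraph) where

  open import Data.Nat using (ℕ; zero; suc; _+_; _*_; _≤_)
  open import Data.Nat.Properties
    using (≤-trans; ≤-refl; n≤1+n; <⇒≱; *-zeroʳ; *-identityʳ; +-identityʳ; m+1+n≢0; module ≤-Reasoning)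
  open import Data.Empty using (⊥)
  open import Data.Bool using (true; false; _∧_; not)
  open import Data.Bool.Properties using (∧-identityʳ; ∧-zeroʳ; not-involutive)
  open import Data.Fin using (Fin; zero; suc)
  open import Data.List using (List)
  open import Data.List.Membership.Propositional using (_∈_)
  open import Data.Product using (_×_; _,_; proj₁; proj₂; ∃)
  open import Data.Sum using (_⊎_; inj₁; inj₂)
  open import Function using (_∘_)
  open import Function.Bundles using (module Equivalence)
  open import Relation.Nullary using (¬_; contradiction)
  open import Relation.Binary.PropositionalEquality

  open Counting
  open Digraph G
  open Flow G
  open Residual G

  open RootedDigraph G

  -- An integral r–v flow of value j under unit capacities, given by the set of edges that carry flow.
  IsFlow : EdgeSet G → V → ℕ → Set
  IsFlow D v j = Balanced D (units r j) (units v j)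

  empty-flow : ∀ v → IsFlow (λ _ → false) v 0
  empty-flow v w = refl

  flow-across : ∀ {D v j X} → IsFlow D v j → X r ≡ false → X v ≡ true → ϱ D X ≡ δ D X + j
  flow-across {D} {v} {j} {X} flow Xr Xv = begin
    ϱ D X                          ≡⟨ +-identityʳ (ϱ D X) ⟨
    ϱ D X + 0                      ≡⟨ cong (ϱ D X +_) (*-zeroʳ j) ⟨
    ϱ D X + j * ⟦ false ⟧          ≡⟨ cong (λ b → ϱ D X + j * ⟦ b ⟧) Xr ⟨
    ϱ D X + j * ⟦ X r ⟧            ≡⟨ cong (ϱ D X +_) (sumOver-point X r j) ⟨
    ϱ D X + sumOver X (units r j)  ≡⟨ balanced-cut flow X ⟩
    δ D X + sumOver X (units v j)  ≡⟨ cong (δ D X +_) (sumOver-point X v j) ⟩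
    δ D X + j * ⟦ X v ⟧            ≡⟨ cong (λ b → δ D X + j * ⟦ b ⟧) Xv ⟩
    δ D X + j * 1                  ≡⟨ cong (δ D X +_) (*-identityʳ j) ⟩
    δ D X + j                      ∎
    where open ≡-Reasoning

  closed⇒ϱ≡0 : ∀ {S D R} → Closed S D R → ϱ D R ≡ 0
  closed⇒ϱ≡0 {S} {D} {R} closed = count-none {k} none
    where
    none : ∀ e → (D e ∧ enters R e) ≡ false
    none e with D e in De | R (hd e) in Rhd | R (tl e) in Rtl
    ... | false | _ | _ = refl
    ... | true | false | _ = refl
    ... | true | true | true = refl
    ... | true | true | false = contradiction (trans (sym (proj₂ (closed e) De Rhd)) Rtl) λ ()

  δ-complement : ∀ D R → δ D (not ∘ R) ≡ ϱ D R
  δ-complement D R = count-cong {k} λ e → cong (D e ∧_) (leaves-complement (R (hd e)) (R (tl e)))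
    where
    leaves-complement : ∀ h t → (not t ∧ not (not h)) ≡ (h ∧ not t)
    leaves-complement true t = ∧-identityʳ (not t)
    leaves-complement false t = ∧-zeroʳ (not t)

  closed⇒ϱ-mono : ∀ {S D R} → Closed S D R → ϱ S (not ∘ R) ≤ ϱ D (not ∘ R)
  closed⇒ϱ-mono {S} {D} {R} closed = count-mono {k} crossing-in-D
    where
    crossing-in-D : ∀ e → (S e ∧ enters (not ∘ R) e) ≡ true → (D e ∧ enters (not ∘ R) e) ≡ true
    crossing-in-D e h with ∧-true (S e) h
    ... | Se , enters-e with ∧-true (not (R (hd e))) enters-e | D e in De
    ...   | _ | true = enters-e
    ...   | ¬Rhd , ¬¬Rtl | false = contradiction (trans (sym Rhd) (not-true ¬Rhd)) λ ()
      where
      Rhd = proj₁ (closed e) (cong₂ _∧_ Se (cong not De)) (trans (sym (not-involutive _)) ¬¬Rtl)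

  augment-flow : ∀ {S D v j} → D ⊆ S → IsFlow D v j →
                 (∃ λ D′ → IsFlow D′ v (suc j) × D′ ⊆ S) ⊎ (∃ λ X → X r ≡ false × X v ≡ true × ϱ S X ≤ j)
  augment-flow {S} {D} {v} {j} D⊆S flow with Search.search S D r v
  ... | inj₁ (_ , p) = inj₁ (D′ , balanced , D′⊆S)
    where open Augmented (augment D⊆S (Equivalence.to (balanced-token r) flow) p)
  ... | inj₂ (R , Rr , Rv , closed) = inj₂ (not ∘ R , cong not Rr , cong not Rv , (begin
    ϱ S (not ∘ R)              ≤⟨ closed⇒ϱ-mono {S} {D} {R} closed ⟩
    ϱ D (not ∘ R)              ≡⟨ flow-across {X = not ∘ R} flow (cong not Rr) (cong not Rv) ⟩
    δ D (not ∘ R) + j          ≡⟨ cong (_+ j) (trans (δ-complement D R) (closed⇒ϱ≡0 {S} {D} {R} closed)) ⟩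
    j                          ∎))
    where open ≤-Reasoning

  max-flow : ∀ {S v} K → (∀ X → X r ≡ false → X v ≡ true → K ≤ ϱ S X) → ∃ λ D → IsFlow D v K × D ⊆ S
  max-flow {S} {v} K K≤cut = flow-of-value K ≤-refl
    where
    flow-of-value : ∀ j → j ≤ K → ∃ λ D → IsFlow D v j × D ⊆ S
    flow-of-value zero _ = (λ _ → false) , empty-flow v , λ _ ()
    flow-of-value (suc j) j<K with flow-of-value j (≤-trans (n≤1+n j) j<K)
    ... | D , flow , D⊆S with augment-flow D⊆S flow
    ...   | inj₁ larger = larger
    ...   | inj₂ (X , Xr , Xv , ϱ≤j) = contradiction (≤-trans (K≤cut X Xr Xv) ϱ≤j) (<⇒≱ j<K)

  -- Cancelling a path from the sink back to the source removes one unit of flow.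
  decompose : ∀ {v} j D → IsFlow D v j → DisjointPaths G D v j
  decompose zero D flow = (λ ()) , (λ ()) , λ ()
  decompose {v} (suc j) D flow with Search.search D D v r
  ... | inj₂ (R , Rv , Rr , closed) = contradiction
    (trans (sym (closed⇒ϱ≡0 {D} {D} {R} closed)) (flow-across {D} {v} {suc j} {R} flow Rr Rv)) (m+1+n≢0 (δ D R) ∘ sym)
  ... | inj₁ (_ , p) = P , paths , disjoint
    where
    open Augmented (augment (λ _ De → De) flow p)
    path = proj₁ (backward-path p)
    rest = decompose j D′ (Equivalence.from (balanced-token r) balanced)
    rest-walk : ∀ i → Walk G D′ r v (proj₁ rest i)
    rest-walk i = proj₁ (proj₁ (proj₂ rest) i)
    P : Fin (suc j) → List E
    P zero = edges p
    P (suc i) = proj₁ rest i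
    paths : ∀ i → Path G D r v (P i)
    paths zero = path
    paths (suc i) = walk-mono D′⊆S (rest-walk i) , proj₂ (proj₁ (proj₂ rest) i)
    removed : ∀ {e} → e ∈ edges p → D′ e ≡ false
    removed e∈ = trans (flipped e∈) (cong not (walk-⊆ (proj₁ path) e∈))
    disjoint : ∀ i i′ → ¬ i ≡ i′ → ∀ e → e ∈ P i → e ∈ P i′ → ⊥
    disjoint zero zero i≢i′ _ _ _ = i≢i′ refl
    disjoint zero (suc i′) _ e e∈ e∈′ = contradiction (trans (sym (removed e∈)) (walk-⊆ (rest-walk i′) e∈′)) λ ()
    disjoint (suc i) zero _ e e∈ e∈′ = contradiction (trans (sym (removed e∈′)) (walk-⊆ (rest-walk i) e∈)) λ ()
    disjoint (suc i) (suc i′) i≢i′ = proj₂ (proj₂ rest) i i′ (i≢i′ ∘ cong suc)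

  menger : ∀ {S v} K → (∀ X → X r ≡ false → X v ≡ true → K ≤ ϱ S X) → DisjointPaths G S v K
  menger K K≤cut = let (D , flow , D⊆S) = max-flow K K≤cut in disjointPaths-mono D⊆S (decompose K D flow)

  cutCondition⇒flame : ∀ {S} → CutCondition S → IsFlame G S
  cutCondition⇒flame {S} cut v v≢r =
    menger (inDeg G S v) (λ X Xr Xv → subst (_≤ ϱ S X) (sym (inDeg≡indeg S v)) (cut X Xr v Xv)) ,
    λ t paths → subst (t ≤_) (sym (inDeg≡indeg S v)) (disjointPaths≤indeg v≢r paths)


module Branching (G : RootedDigraph) where

  open import Data.Nat using (ℕ; zero; suc; _≤_; _<_; z≤n; s≤s)
  open import Data.Nat.Properties using (<⇒≱; ≤-reflexive; module ≤-Reasoning)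
  open import Data.Bool using (true; _∧_)
  open import Data.Fin using (_≟_)
  open import Relation.Nullary.Decidable using (⌊_⌋)
  open import Data.List using ([]; _∷_; _++_; [_]; length; map)
  open import Data.List.Properties using (length-map)
  open import Data.List.Extrema.Nat using (argmin; argmin-sel; f[argmin]≤f[⊤]; f[argmin]≤f[xs])
  open import Data.List.Membership.Propositional using (_∈_)
  open import Data.List.Membership.Propositional.Properties using (∈-++⁺ʳ; ∈-map⁻)
  open import Data.List.Relation.Unary.Any using (here; there)
  import Data.List.Relation.Unary.All as All
  import Data.List.Relation.Unary.All.Properties as Allᵖ
  open import Data.List.Relation.Unary.Unique.Propositional using (Unique; []; _∷_)
  open import Data.Product using (_×_; _,_; proj₁; proj₂; ∃)
  open import Data.Sum using (inj₁; inj₂)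
  open import Function using (_∘′_)
  open import Relation.Nullary using (¬_)
  open import Relation.Binary.PropositionalEquality hiding ([_])

  open Counting
  open Digraph G

  open RootedDigraph G

  HeadInjective : EdgeSet G → Set
  HeadInjective B = ∀ e₁ e₂ → B e₁ ≡ true → B e₂ ≡ true → hd e₁ ≡ hd e₂ → e₁ ≡ e₂

  Ranked : EdgeSet G → Set
  Ranked B = ∃ λ (ψ : V → ℕ) → ∀ e → B e ≡ true → ψ (tl e) < ψ (hd e)

  headInjective-cong : ∀ {B B′} → B ≗ B′ → HeadInjective B → HeadInjective B′
  headInjective-cong B≗B′ injective e₁ e₂ h₁ h₂ =
    injective e₁ e₂ (trans (B≗B′ e₁) h₁) (trans (B≗B′ e₂) h₂)

  ranked-cong : ∀ {B B′} → B ≗ B′ → Ranked B → Ranked B′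
  ranked-cong B≗B′ (ψ , ranked) = ψ , λ e h → ranked e (trans (B≗B′ e) h)

  uwalk-length : ∀ {B x vs es} → UWalk G B x vs es → length es ≡ length vs
  uwalk-length nil = refl
  uwalk-length (cons _ _ walk) = cong ℕ.suc (uwalk-length walk)

  uwalk-⊆ : ∀ {B x vs es e} → UWalk G B x vs es → e ∈ es → B e ≡ true
  uwalk-⊆ (cons Be _ _) (here refl) = Be
  uwalk-⊆ (cons _ _ walk) (there e∈) = uwalk-⊆ walk e∈

  uwalk-endpoints : ∀ {B x vs es e} → UWalk G B x vs es → e ∈ es → hd e ∈ x ∷ vs × tl e ∈ x ∷ vs
  uwalk-endpoints (cons _ (inj₁ (refl , refl)) _) (here refl) = there (here refl) , here refl
  uwalk-endpoints (cons _ (inj₂ (refl , refl)) _) (here refl) = here refl , there (here refl)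
  uwalk-endpoints (cons _ _ walk) (there e∈) = let (hd∈ , tl∈) = uwalk-endpoints walk e∈ in there hd∈ , there tl∈

  heads-unique : ∀ {B es} → HeadInjective B → (∀ {e} → e ∈ es → B e ≡ true) → Unique es → Unique (map hd es)
  heads-unique {es = []} _ _ [] = []
  heads-unique {B} {e ∷ es} injective ⊆B (e∉ ∷ unique) =
    Allᵖ.map⁺ (All.tabulate λ e′∈ hd≡ → All.lookup e∉ e′∈ (injective _ _ (⊆B (here refl)) (⊆B (there e′∈)) hd≡)) ∷
    heads-unique injective (⊆B ∘′ there) unique

  -- The heads of the cycle's edges are distinct and lie on the cycle, so by counting they cover it. The vertex of
  -- least rank on the cycle is therefore the head of a cycle edge, whose tail has even smaller rank.
  ranked⇒acyclic : ∀ {B} → HeadInjective B → Ranked B → ¬ HasCycle G B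
  ranked⇒acyclic {B} injective (ψ , ranked) (x , ws , es , walk , _ , unique-es) =
    let (e , e∈ , w≡hd) = ∈-map⁻ hd w∈heads in
    <⇒≱ (subst (λ u → ψ (tl e) < ψ u) (sym w≡hd) (ranked e (uwalk-⊆ walk e∈)))
        (minimal (proj₂ (uwalk-endpoints walk e∈)))
    where
    L = ws ++ [ x ]
    x∈L : x ∈ L
    x∈L = ∈-++⁺ʳ ws (here refl)
    narrow : ∀ {u} → u ∈ x ∷ L → u ∈ L
    narrow (here refl) = x∈L
    narrow (there u∈) = u∈
    w = argmin ψ x L
    minimal : ∀ {u} → u ∈ x ∷ L → ψ w ≤ ψ u
    minimal (here refl) = f[argmin]≤f[⊤] {f = ψ} x L
    minimal (there u∈) = All.lookup (f[argmin]≤f[xs] {f = ψ} x L) u∈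
    w∈L : w ∈ L
    w∈L with argmin-sel ψ x L
    ... | inj₁ w≡x = subst (_∈ L) (sym w≡x) x∈L
    ... | inj₂ w∈ = w∈
    heads-on-cycle : ∀ {u} → u ∈ map hd es → u ∈ L
    heads-on-cycle u∈ with ∈-map⁻ hd u∈
    ... | e , e∈ , refl = narrow (proj₁ (uwalk-endpoints walk e∈))
    w∈heads : w ∈ map hd es
    w∈heads = unique-⊆-length⇒⊇ (heads-unique injective (uwalk-⊆ walk) unique-es) heads-on-cycle
                (≤-reflexive (trans (sym (uwalk-length walk)) (sym (length-map hd es)))) w∈L

  ranked⇒branching : ∀ {B} → HeadInjective B → Ranked B → IsBranching G B
  ranked⇒branching injective ranked = ranked⇒acyclic injective ranked , injective

  injective⇒indeg≤1 : ∀ {B} → HeadInjective B → ∀ w → indeg B w ≤ 1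
  injective⇒indeg≤1 {B} injective w with indeg B w in indeg≡
  ... | zero = z≤n
  ... | suc d with count-witness {k} (λ e → B e ∧ ⌊ hd e ≟ w ⌋) (subst (0 <_) (sym indeg≡) (s≤s z≤n))
  ...   | e₀ , h₀ = subst (_≤ 1) indeg≡ (begin
    count (λ e → B e ∧ ⌊ hd e ≟ w ⌋)  ≤⟨ count-mono {k} same-edge ⟩
    count (λ e → true ∧ ⌊ e ≟ e₀ ⌋)   ≡⟨ count-single (λ _ → true) e₀ ⟩
    1                                 ∎)
    where
    open ≤-Reasoning
    same-edge : ∀ e → (B e ∧ ⌊ hd e ≟ w ⌋) ≡ true → ⌊ e ≟ e₀ ⌋ ≡ true
    same-edge e h =
      let (Be , hd≡w) = ∧-true (B e) h ; (Be₀ , hd₀≡w) = ∧-true (B e₀) h₀ in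
      ⌊⌋-true (e ≟ e₀) (injective e e₀ Be Be₀ (trans (fromTrue (hd e ≟ w) hd≡w) (sym (fromTrue (hd e₀ ≟ w) hd₀≡w))))


module Peeling (G : RootedDigraph) where

  open import Data.Nat as ℕ using (ℕ; zero; suc; _+_; _≤_; _<_; z≤n; s≤s)
  open import Data.Nat.Properties
    using (≤-trans; ≤-reflexive; ≤-refl; ≤-antisym; ≤-pred; n≤1+n; <⇒≢; <⇒≱; ≰⇒>; n≤0⇒n≡0; n≢0⇒n>0; m≤n⇒m<n∨m≡n;
           +-mono-≤; +-monoʳ-≤; +-cancelʳ-≤; suc-injective; _≤?_; module ≤-Reasoning)
  open import Data.Bool using (Bool; true; false; _∧_; _∨_; not)
  import Data.Bool as Bool
  open import Data.Bool.Properties using (∧-identityʳ; ∧-zeroʳ; ¬-not)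
  open import Data.Fin using (_≟_)
  open import Data.Fin.Properties using (any?)
  open import Data.Product using (_×_; _,_; proj₁; proj₂; ∃)
  open import Data.Sum using (inj₁; inj₂; [_,_]′)
  open import Function using (_∘_)
  open import Function.Bundles using (_⇔_; mk⇔)
  open import Relation.Nullary using (Dec; yes; no; ¬_; contradiction; _×-dec_)
  open import Relation.Nullary.Decidable using (⌊_⌋)
  open import Relation.Binary.PropositionalEquality

  open Counting
  open Digraph G
  open Branching G

  open RootedDigraph G

  module _ (S : EdgeSet G) (cut : CutCondition S) (m : ℕ) (indeg≤ : ∀ w → ¬ w ≡ r → indeg S w ≤ suc m) where

    Top : VertexSet
    Top w = not ⌊ w ≟ r ⌋ ∧ ⌊ indeg S w ℕ.≟ suc m ⌋

    top-root : Top r ≡ false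
    top-root = cong (λ b → not b ∧ ⌊ indeg S r ℕ.≟ suc m ⌋) (≟-refl r)

    top⇒ : ∀ {w} → Top w ≡ true → ¬ w ≡ r × indeg S w ≡ suc m
    top⇒ {w} top = let (w≢r , full) = ∧-true (not ⌊ w ≟ r ⌋) top in
      fromFalse (w ≟ r) (not-true w≢r) , fromTrue (indeg S w ℕ.≟ suc m) full

    ⇒top : ∀ {w} → ¬ w ≡ r → indeg S w ≡ suc m → Top w ≡ true
    ⇒top {w} w≢r full = cong₂ _∧_ (cong not (⌊⌋-false (w ≟ r) w≢r)) (⌊⌋-true (indeg S w ℕ.≟ suc m) full)

    ¬top⇒ : ∀ {w} → Top w ≡ false → ¬ w ≡ r → indeg S w ≤ m
    ¬top⇒ {w} ¬top w≢r with m≤n⇒m<n∨m≡n (indeg≤ w w≢r)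
    ... | inj₁ lt = ≤-pred lt
    ... | inj₂ full = contradiction (trans (sym (⇒top w≢r full)) ¬top) λ ()

    Needy : EdgeSet G → VertexSet
    Needy B w = Top w ∧ ⌊ indeg B w ℕ.≟ 0 ⌋

    needy⇒top : ∀ {B w} → Needy B w ≡ true → Top w ≡ true
    needy⇒top {w = w} = proj₁ ∘ ∧-true (Top w)

    needy⇒uncovered : ∀ {B w e} → Needy B w ≡ true → B e ≡ true → ¬ hd e ≡ w
    needy⇒uncovered {B} {w} needy Be refl =
      <⇒≢ (indeg-pos Be) (sym (fromTrue (indeg B w ℕ.≟ 0) (proj₂ (∧-true (Top w) needy))))

    ¬needy⇒covered : ∀ {B w} → Top w ≡ true → Needy B w ≡ false → 0 < indeg B w
    ¬needy⇒covered {B} {w} top ¬needy =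
      n≢0⇒n>0 (fromFalse (indeg B w ℕ.≟ 0) (subst (λ t → t ∧ _ ≡ false) top ¬needy))

    needy-insert : ∀ {B e w} → Needy (insert e B) w ≡ true → Needy B w ≡ true
    needy-insert {B} {e} {w} needy = let (top , uncovered) = ∧-true (Top w) needy in
      cong₂ _∧_ top (⌊⌋-true (indeg B w ℕ.≟ 0) (n≤0⇒n≡0 (subst (indeg B w ≤_)
        (fromTrue (indeg (insert e B) w ℕ.≟ 0) uncovered) (indeg-mono (⊆-insert {p = B}) w))))

    ¬needy-insert : ∀ {B e w} → Needy B w ≡ false → Needy (insert e B) w ≡ false
    ¬needy-insert {B} {e} ¬needy = ¬-not λ needy → contradiction (trans (sym (needy-insert {B} {e} needy)) ¬needy) λ ()

    needy-inserted : ∀ {B e} → Needy (insert e B) (hd e) ≡ false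
    needy-inserted {B} {e} = trans (cong (Top (hd e) ∧_) (⌊⌋-false (_ ℕ.≟ 0) covered)) (∧-zeroʳ (Top (hd e)))
      where
      covered : ¬ indeg (insert e B) (hd e) ≡ 0
      covered = <⇒≢ (indeg-pos {insert e B} (cong (Bool._∨ B e) (≟-refl e))) ∘ sym

    record Partial (B : EdgeSet G) : Set where
      field
        B⊆S : B ⊆ S
        heads-top : ∀ e → B e ≡ true → Top (hd e) ≡ true
        injective : HeadInjective B
        ranked : Ranked B
        tails-covered : ∀ e → B e ≡ true → Needy B (tl e) ≡ false
        top-cuts : ∀ X → X r ≡ false → ∀ u → X u ≡ true → Top u ≡ true → m ≤ ϱ (S ∖ B) X

    record Safe (B : EdgeSet G) (e : E) : Set where
      field
        residual : (S ∖ B) e ≡ true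
        head-needy : Needy B (hd e) ≡ true
        tail-not-needy : Needy B (tl e) ≡ false
        cuts : ∀ X → X r ≡ false → enters X e ≡ true → suc m ≤ ϱ (S ∖ B) X

    empty-partial : Partial (λ _ → false)
    empty-partial = record
      { B⊆S = λ _ ()
      ; heads-top = λ _ ()
      ; injective = λ _ _ ()
      ; ranked = (λ _ → 0) , λ _ ()
      ; tails-covered = λ _ ()
      ; top-cuts = λ X Xr u Xu top → ≤-trans (n≤1+n m) (begin
          suc m                          ≡⟨ proj₂ (top⇒ top) ⟨
          indeg S u                      ≤⟨ cut X Xr u Xu ⟩
          ϱ S X                          ≡⟨ count-cong {k} (λ e → cong (_∧ enters X e) (∧-identityʳ (S e))) ⟨
          ϱ (S ∖ (λ _ → false)) X        ∎) }
      where open ≤-Reasoning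

    ϱ-insert : ∀ {B e} X → (S ∖ B) e ≡ true → ϱ (S ∖ B) X ≡ ⟦ enters X e ⟧ + ϱ (S ∖ insert e B) X
    ϱ-insert {B} {e} X residual = trans (count-delete {p = S ∖ B} (enters X) residual)
      (cong (⟦ enters X e ⟧ +_) (count-cong (λ e′ → cong (_∧ enters X e′) (delete≡∖insert e′))))
      where
      delete≡∖insert : ∀ e′ → delete e (S ∖ B) e′ ≡ (S ∖ insert e B) e′
      delete≡∖insert e′ with e′ ≟ e
      ... | yes refl = trans (∧-zeroʳ _) (sym (∧-zeroʳ (S e′)))
      ... | no _ = ∧-identityʳ _

    extend : ∀ {B e} → Partial B → Safe B e → Partial (insert e B)
    extend {B} {e} partial safe = record
      { B⊆S = insert-⊆ {p = B} Se B⊆S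
      ; heads-top = λ e′ h → [ (λ { refl → needy⇒top head-needy }) , heads-top e′ ]′ (insert⁻ {p = B} h)
      ; injective = injective′
      ; ranked = ψ′ , ranked′
      ; tails-covered = λ e′ h →
          ¬needy-insert {B} {e} ([ (λ { refl → tail-not-needy }) , tails-covered e′ ]′ (insert⁻ {p = B} h))
      ; top-cuts = top-cuts′ }
      where
      open Partial partial
      open Safe safe
      Se : S e ≡ true
      Se = ∖-⊆ {S} {B} e residual
      distinct : ∀ {w} → Needy B w ≡ false → ¬ w ≡ hd e
      distinct ¬needy refl = contradiction (trans (sym ¬needy) head-needy) λ ()
      injective′ : HeadInjective (insert e B)
      injective′ e₁ e₂ h₁ h₂ hd≡ with insert⁻ {p = B} h₁ | insert⁻ {p = B} h₂
      ... | inj₁ refl | inj₁ refl = refl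
      ... | inj₁ refl | inj₂ Be₂ = contradiction (sym hd≡) (needy⇒uncovered head-needy Be₂)
      ... | inj₂ Be₁ | inj₁ refl = contradiction hd≡ (needy⇒uncovered head-needy Be₁)
      ... | inj₂ Be₁ | inj₂ Be₂ = injective e₁ e₂ Be₁ Be₂ hd≡
      ψ = proj₁ ranked
      -- hd e is neither the head nor, by tails-covered, the tail of an edge of B, so it can be ranked above tl e.
      ψ′ : V → ℕ
      ψ′ w = Bool.if ⌊ w ≟ hd e ⌋ then suc (ψ (tl e)) else ψ w
      ψ′-head : ψ′ (hd e) ≡ suc (ψ (tl e))
      ψ′-head rewrite ≟-refl (hd e) = refl
      ψ′-other : ∀ {w} → ¬ w ≡ hd e → ψ′ w ≡ ψ w
      ψ′-other {w} w≢hd rewrite ⌊⌋-false (w ≟ hd e) w≢hd = refl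
      ranked′ : ∀ e′ → insert e B e′ ≡ true → ψ′ (tl e′) < ψ′ (hd e′)
      ranked′ e′ h with insert⁻ {p = B} h
      ... | inj₁ refl = subst₂ _<_ (sym (ψ′-other (distinct tail-not-needy))) (sym ψ′-head) ≤-refl
      ... | inj₂ Be′ = subst₂ _<_ (sym (ψ′-other (distinct (tails-covered e′ Be′))))
                                  (sym (ψ′-other (needy⇒uncovered head-needy Be′))) (proj₂ ranked e′ Be′)
      top-cuts′ : ∀ X → X r ≡ false → ∀ u → X u ≡ true → Top u ≡ true → m ≤ ϱ (S ∖ insert e B) X
      top-cuts′ X Xr u Xu top with enters X e in entering | ϱ-insert {B} {e} X residual
      ... | true | split = ≤-pred (subst (suc m ≤_) split (cuts X Xr entering))
      ... | false | split = subst (m ≤_) split (top-cuts X Xr u Xu top)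

    TightNeedy : EdgeSet G → VertexSet → Set
    TightNeedy B X = X r ≡ false × ϱ (S ∖ B) X ≤ m × ∃ λ u → X u ≡ true × Needy B u ≡ true

    tightNeedy? : ∀ B X → Dec (TightNeedy B X)
    tightNeedy? B X =
      X r Bool.≟ false ×-dec ϱ (S ∖ B) X ≤? m ×-dec any? λ u → X u Bool.≟ true ×-dec Needy B u Bool.≟ true

    tightNeedy-cong : ∀ {B X Y} → (∀ w → X w ≡ Y w) → TightNeedy B X → TightNeedy B Y
    tightNeedy-cong {B} X≗Y (Xr , ϱ≤m , u , Xu , needy) =
      trans (sym (X≗Y r)) Xr ,
      subst (_≤ m) (count-cong {k} λ e → cong₂ (λ h t → (S ∖ B) e ∧ (h ∧ not t)) (X≗Y (hd e)) (X≗Y (tl e))) ϱ≤m ,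
      u , trans (sym (X≗Y u)) Xu , needy

    not-tight : ∀ {B X u} → ¬ TightNeedy B X → X r ≡ false → X u ≡ true → Needy B u ≡ true → suc m ≤ ϱ (S ∖ B) X
    not-tight {B} {X} ¬tight Xr Xu needy with ϱ (S ∖ B) X ≤? m
    ... | yes ϱ≤m = contradiction (Xr , ϱ≤m , _ , Xu , needy) ¬tight
    ... | no ϱ≰m = ≰⇒> ϱ≰m

    -- Without tight sets, any residual edge entering the set of needy vertices is safe.
    safe-if-none-tight : ∀ {B u} → (∀ X → ¬ TightNeedy B X) → Needy B u ≡ true → ∃ (Safe B)
    safe-if-none-tight {B} none needy = e , record
      { residual = proj₁ (∧-true ((S ∖ B) e) h)
      ; head-needy = proj₁ (∧-true (Needy B (hd e)) entering)
      ; tail-not-needy = not-true (proj₂ (∧-true (Needy B (hd e)) entering))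
      ; cuts = λ X Xr entering-X → not-tight (none X) Xr (proj₁ (∧-true (X (hd e)) entering-X))
                                             (proj₁ (∧-true (Needy B (hd e)) entering)) }
      where
      needy-set-entered : 0 < ϱ (S ∖ B) (Needy B)
      needy-set-entered =
        ≤-trans (s≤s z≤n) (not-tight (none (Needy B)) (cong (_∧ ⌊ indeg B r ℕ.≟ 0 ⌋) top-root) needy needy)
      e = proj₁ (count-witness {k} _ needy-set-entered)
      h = proj₂ (count-witness {k} _ needy-set-entered)
      entering = proj₂ (∧-true ((S ∖ B) e) h)

    Minimal : EdgeSet G → VertexSet → Set
    Minimal B T = TightNeedy B T × ∀ Y → TightNeedy B Y → count T ≤ count Y

    InnerEdge : EdgeSet G → VertexSet → E → Set
    InnerEdge B T e = (S ∖ B) e ≡ true × T (tl e) ≡ true × Needy B (tl e) ≡ false ×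
                                         T (hd e) ≡ true × Needy B (hd e) ≡ true

    -- Without such an edge, every edge entering the needy part of T enters T, so that part is tight and by minimality
    -- is all of T; then no edge entering T lies in B, and the cut condition for S gives m + 1 ≤ ϱ (S ∖ B) T.
    minimal⇒inner-edge : ∀ {B T} → Minimal B T → ∃ (InnerEdge B T)
    minimal⇒inner-edge {B} {T} ((Tr , ϱT≤m , u , Tu , needy-u) , minimal)
      with any? (λ e → (S ∖ B) e Bool.≟ true ×-dec T (tl e) Bool.≟ true ×-dec Needy B (tl e) Bool.≟ false ×-dec
                       T (hd e) Bool.≟ true ×-dec Needy B (hd e) Bool.≟ true)
    ... | yes inner = inner
    ... | no none = contradiction (begin
        suc m             ≡⟨ proj₂ (top⇒ (needy⇒top needy-u)) ⟨
        indeg S u         ≤⟨ cut T Tr u Tu ⟩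
        ϱ S T             ≤⟨ count-mono {k} entering-residual ⟩
        ϱ (S ∖ B) T       ≤⟨ ϱT≤m ⟩
        m                 ∎) (<⇒≱ ≤-refl)
      where
      open ≤-Reasoning
      Z : VertexSet
      Z w = T w ∧ Needy B w
      entering-Z⇒entering-T : ∀ e → ((S ∖ B) e ∧ enters Z e) ≡ true → ((S ∖ B) e ∧ enters T e) ≡ true
      entering-Z⇒entering-T e h with ∧-true ((S ∖ B) e) h
      ... | residual , entering with ∧-true (Z (hd e)) entering | T (tl e) in Ttl
      ...   | Zhd , _ | false = cong₂ _∧_ residual (cong₂ _∧_ (proj₁ (∧-true (T (hd e)) Zhd)) refl)
      ...   | Zhd , ¬Ztl | true = contradiction
              (e , residual , Ttl , not-true (subst (λ t → not (t ∧ _) ≡ true) Ttl ¬Ztl) , ∧-true (T (hd e)) Zhd) none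
      Z-tight : TightNeedy B Z
      Z-tight = cong (_∧ _) Tr , ≤-trans (count-mono {k} entering-Z⇒entering-T) ϱT≤m , u , cong₂ _∧_ Tu needy-u , needy-u
      all-needy : ∀ w → T w ≡ true → Needy B w ≡ true
      all-needy w Tw with Needy B w in needy-w
      ... | true = refl
      ... | false = contradiction (minimal Z Z-tight) (<⇒≱ Z<T)
        where
        Z<T : count Z < count T
        Z<T = count-mono-< {p = Z} {q = T} w (λ w′ h → proj₁ (∧-true (T w′) h))
                           (trans (cong (T w ∧_) needy-w) (∧-zeroʳ (T w))) Tw
      entering-residual : ∀ e → (S e ∧ enters T e) ≡ true → ((S ∖ B) e ∧ enters T e) ≡ true
      entering-residual e h with ∧-true (S e) h | B e in Be
      ... | Se , entering | false = cong₂ _∧_ (cong (_∧ true) Se) entering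
      ... | Se , entering | true =
            contradiction refl (needy⇒uncovered (all-needy (hd e) (proj₁ (∧-true (T (hd e)) entering))) Be)

    -- If X were entered by e with ϱ (S ∖ B) X ≤ m, submodularity would make X ∩ T a tight set
    -- (X ∪ T contains the top vertex hd e, so ϱ (S ∖ B) (X ∪ T) ≥ m) missing tl e, contradicting minimality.
    inner-edge⇒safe : ∀ {B T e} → Partial B → Minimal B T → InnerEdge B T e → Safe B e
    inner-edge⇒safe {B} {T} {e} partial ((Tr , ϱT≤m , _) , minimal) (residual , Ttl , ¬needy-tl , Thd , needy-hd) = record
      { residual = residual ; head-needy = needy-hd ; tail-not-needy = ¬needy-tl ; cuts = cuts }
      where
      cuts : ∀ X → X r ≡ false → enters X e ≡ true → suc m ≤ ϱ (S ∖ B) X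
      cuts X Xr entering with ϱ (S ∖ B) X ≤? m
      ... | no ϱ≰m = ≰⇒> ϱ≰m
      ... | yes ϱX≤m = contradiction (minimal X∩T X∩T-tight) (<⇒≱ X∩T<T)
        where
        X∩T X∪T : VertexSet
        X∩T w = X w ∧ T w
        X∪T w = X w ∨ T w
        Xhd = proj₁ (∧-true (X (hd e)) entering)
        Xtl = not-true (proj₂ (∧-true (X (hd e)) entering))
        union-cut : m ≤ ϱ (S ∖ B) X∪T
        union-cut = Partial.top-cuts partial X∪T (cong₂ _∨_ Xr Tr) (hd e) (cong (_∨ T (hd e)) Xhd) (needy⇒top needy-hd)
        intersection-cut : ϱ (S ∖ B) X∩T ≤ m
        intersection-cut = +-cancelʳ-≤ (ϱ (S ∖ B) X∪T) _ _ (begin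
          ϱ (S ∖ B) X∩T + ϱ (S ∖ B) X∪T  ≤⟨ ϱ-submodular (S ∖ B) X T ⟩
          ϱ (S ∖ B) X + ϱ (S ∖ B) T      ≤⟨ +-mono-≤ ϱX≤m ϱT≤m ⟩
          m + m                          ≤⟨ +-monoʳ-≤ m union-cut ⟩
          m + ϱ (S ∖ B) X∪T              ∎)
          where open ≤-Reasoning
        X∩T-tight : TightNeedy B X∩T
        X∩T-tight = cong (_∧ T r) Xr , intersection-cut , hd e , cong₂ _∧_ Xhd Thd , needy-hd
        X∩T<T : count X∩T < count T
        X∩T<T = count-mono-< {p = X∩T} {q = T} (tl e) (λ w h → proj₂ (∧-true (X w) h)) (cong (_∧ T (tl e)) Xtl) Ttl

    safe-edge : ∀ {B u} → Partial B → Needy B u ≡ true → ∃ (Safe B)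
    safe-edge {B} partial needy with none-or-minimal (TightNeedy B) (tightNeedy? B) tightNeedy-cong
    ... | inj₁ none = safe-if-none-tight none needy
    ... | inj₂ (T , minimal) = let (e , inner) = minimal⇒inner-edge minimal in e , inner-edge⇒safe partial minimal inner

    -- Every safe edge covers one more needy vertex.
    complete : ∀ fuel {B} → Partial B → count (Needy B) ≤ fuel → ∃ λ B′ → Partial B′ × ∀ w → Needy B′ w ≡ false
    complete fuel {B} partial bound with any? (λ w → Needy B w Bool.≟ true)
    ... | no none = B , partial , λ w → ¬-not (none ∘ (w ,_))
    ... | yes (u , needy) with safe-edge partial needy | fuel
    ...   | e , safe | zero =
            contradiction (≤-trans (count-mono-< {p = λ _ → false} {q = Needy B} u (λ _ ()) refl needy) bound) λ ()
    ...   | e , safe | suc fuel′ = complete fuel′ (extend partial safe) (≤-pred (≤-trans fewer bound))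
      where
      fewer : count (Needy (insert e B)) < count (Needy B)
      fewer = count-mono-< {p = Needy (insert e B)} {q = Needy B} (hd e)
                (λ w → needy-insert {B} {e}) (needy-inserted {B} {e}) (Safe.head-needy safe)

    module Completed {B} (partial : Partial B) (done : ∀ w → Needy B w ≡ false) where
      open Partial partial

      covered : ∀ {v} → Top v ≡ true → InHeadSet G B v
      covered {v} top = let (e , h) = count-witness {k} _ (¬needy⇒covered top (done v)) ; (Be , hd≡) = ∧-true (B e) h in
        e , Be , fromTrue (hd e ≟ v) hd≡

      indeg-B : ∀ w → indeg B w ≡ ⟦ Top w ⟧
      indeg-B w with Top w in top
      ... | true = ≤-antisym (injective⇒indeg≤1 injective w) (¬needy⇒covered top (done w))
      ... | false = count-none {k} not-entering
        where
        not-entering : ∀ e → (B e ∧ ⌊ hd e ≟ w ⌋) ≡ false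
        not-entering e with B e in Be | hd e ≟ w
        ... | false | _ = refl
        ... | true | no _ = refl
        ... | true | yes refl = contradiction (trans (sym (heads-top e Be)) top) λ ()

      indeg-split : ∀ w → indeg S w ≡ ⟦ Top w ⟧ + indeg (S ∖ B) w
      indeg-split w = begin
        indeg S w
          ≡⟨ count-split (λ e → S e ∧ ⌊ hd e ≟ w ⌋) B ⟩
        count (λ e → (S e ∧ ⌊ hd e ≟ w ⌋) ∧ B e) + count (λ e → (S e ∧ ⌊ hd e ≟ w ⌋) ∧ not (B e))
          ≡⟨ cong₂ _+_ (count-cong in-B) (count-cong (λ e → ∧-swapʳ (S e) _ _)) ⟩
        indeg B w + indeg (S ∖ B) w
          ≡⟨ cong (_+ indeg (S ∖ B) w) (indeg-B w) ⟩
        ⟦ Top w ⟧ + indeg (S ∖ B) w ∎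
        where
        open ≡-Reasoning
        in-B : ∀ e → ((S e ∧ ⌊ hd e ≟ w ⌋) ∧ B e) ≡ (B e ∧ ⌊ hd e ≟ w ⌋)
        in-B e with B e in Be
        ... | true = trans (∧-identityʳ _) (cong (_∧ ⌊ hd e ≟ w ⌋) (B⊆S e Be))
        ... | false = ∧-zeroʳ _

      rest-indeg≤ : ∀ w → ¬ w ≡ r → indeg (S ∖ B) w ≤ m
      rest-indeg≤ w w≢r with Top w in top
      ... | true = ≤-reflexive (suc-injective (trans (sym split) (proj₂ (top⇒ top))))
        where split = trans (indeg-split w) (cong (λ t → ⟦ t ⟧ + indeg (S ∖ B) w) top)
      ... | false = subst (_≤ m) split (¬top⇒ top w≢r)
        where split = trans (indeg-split w) (cong (λ t → ⟦ t ⟧ + indeg (S ∖ B) w) top)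

      rest-cut : CutCondition (S ∖ B)
      rest-cut X Xr w Xw with any? (λ u → X u Bool.≟ true ×-dec Top u Bool.≟ true)
      ... | yes (u , Xu , top) = ≤-trans (rest-indeg≤ w w≢r) (top-cuts X Xr u Xu top)
        where
        w≢r : ¬ w ≡ r
        w≢r refl = contradiction (trans (sym Xr) Xw) λ ()
      ... | no no-top = begin
        indeg (S ∖ B) w   ≤⟨ indeg-mono ∖-⊆ w ⟩
        indeg S w         ≤⟨ cut X Xr w Xw ⟩
        ϱ S X             ≤⟨ count-mono {k} entering-residual ⟩
        ϱ (S ∖ B) X       ∎
        where
        open ≤-Reasoning
        entering-residual : ∀ e → (S e ∧ enters X e) ≡ true → ((S ∖ B) e ∧ enters X e) ≡ true
        entering-residual e h with ∧-true (S e) h | B e in Be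
        ... | Se , entering | false = cong₂ _∧_ (cong (_∧ true) Se) entering
        ... | Se , entering | true = contradiction (hd e , proj₁ (∧-true (X (hd e)) entering) , heads-top e Be) no-top

      rest-root : indeg S r ≡ 0 → indeg (S ∖ B) r ≡ 0
      rest-root root-source =
        trans (sym (trans (indeg-split r) (cong (λ t → ⟦ t ⟧ + indeg (S ∖ B) r) top-root))) root-source

      threshold : ∀ {t} v → t ≤ m → t ≤ indeg (S ∖ B) v ⇔ t ≤ indeg S v
      threshold {t} v t≤m with Top v in top
      ... | true = mk⇔ (λ _ → ≤-trans t≤m (≤-trans (n≤1+n m) (≤-reflexive (sym (proj₂ (top⇒ top))))))
                       (λ _ → subst (t ≤_) (sym (suc-injective (trans (sym split) (proj₂ (top⇒ top))))) t≤m)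
        where split = trans (indeg-split v) (cong (λ b → ⟦ b ⟧ + indeg (S ∖ B) v) top)
      ... | false = mk⇔ (subst (t ≤_) (sym split)) (subst (t ≤_) split)
        where split = trans (indeg-split v) (cong (λ b → ⟦ b ⟧ + indeg (S ∖ B) v) top)

      top-heads : ∀ v → InHeadSet G B v ⇔ (¬ v ≡ r × suc m ≤ indeg S v)
      top-heads v = mk⇔
        (λ { (e , Be , refl) → let (v≢r , full) = top⇒ (heads-top e Be) in v≢r , ≤-reflexive (sym full) })
        (λ (v≢r , m<indeg) → covered (⇒top v≢r (≤-antisym (indeg≤ v v≢r) m<indeg)))

    peel : ∃ λ B → Partial B × ∀ w → Needy B w ≡ false
    peel = complete (suc n) empty-partial (count≤n (Needy (λ _ → false)))


open Counting
open import Data.Nat using (zero; _<_)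
open import Data.Nat.Properties using (n≤0⇒n≡0; <⇒≱)
import Data.Nat as ℕ
open import Data.Bool using (Bool; true; false; _∧_; not)
import Data.Bool as Bool
open import Data.Bool.Properties using (∧-identityʳ; ∧-zeroʳ)
open import Data.Fin using (zero; suc; fromℕ; inject₁; _≟_)
open import Data.Fin.Properties using (toℕ-fromℕ; toℕ-inject₁; toℕ<n; toℕ≤pred[n]; fromℕ≢inject₁; inject₁-injective)
open import Data.Product using (_,_; proj₁; proj₂)
open import Function using (_∘_)
open import Function.Properties.Equivalence using () renaming (refl to ⇔-refl; trans to ⇔-trans)
open import Data.Product.Function.NonDependent.Propositional using (_×-⇔_)
open import Relation.Nullary using (yes; no)
open import Relation.Nullary.Decidable using (⌊_⌋)
open import Relation.Binary.PropositionalEquality using (refl; sym; trans; cong; cong₂; subst; subst₂; _≗_)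


data LastOrInject : ∀ {m} → Fin (suc m) → Set where
  last : ∀ {m} → LastOrInject (fromℕ m)
  inject : ∀ {m} (j : Fin m) → LastOrInject (inject₁ j)

lastOrInject : ∀ {m} (i : Fin (suc m)) → LastOrInject i
lastOrInject {zero} zero = last
lastOrInject {suc m} zero = inject zero
lastOrInject {suc m} (suc i) with lastOrInject i
... | last = last
... | inject j = inject (suc j)

⌊inject₁≟inject₁⌋ : ∀ {m} (i j : Fin m) → ⌊ inject₁ i ≟ inject₁ j ⌋ ≡ ⌊ i ≟ j ⌋
⌊inject₁≟inject₁⌋ i j with i ≟ j
... | yes refl = ≟-refl (inject₁ i)
... | no i≢j = ⌊⌋-false (inject₁ i ≟ inject₁ j) (i≢j ∘ inject₁-injective)

module _ (G : RootedDigraph) where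
  open RootedDigraph G
  open Digraph G
  open Branching G
  open Peeling G

  _∩_ : EdgeSet G → EdgeSet G → EdgeSet G
  (S ∩ T) e = S e ∧ T e

  record Layer (S : EdgeSet G) {m} (c : E → Fin m) (i : Fin m) : Set where
    field
      injective : HeadInjective (S ∩ classOf G c i)
      ranked : Ranked (S ∩ classOf G c i)
      heads : ∀ v → InHeadSet G (S ∩ classOf G c i) v ⇔ (¬ v ≡ r × suc (toℕ i) ≤ indeg S v)
      cut : CutCondition (S ∩ upTo G c i)

  module Peeled {m S} (cut : CutCondition S) (indeg≤ : ∀ w → ¬ w ≡ r → indeg S w ≤ suc m) where
    B = proj₁ (peel S cut m indeg≤)
    partial = proj₁ (proj₂ (peel S cut m indeg≤))
    open Partial partial public
    open Completed S cut m indeg≤ partial (proj₂ (proj₂ (peel S cut m indeg≤))) public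

    top-layer : ∀ {c : E → Fin (suc m)} {i} → (S ∩ classOf G c i) ≗ B → (S ∩ upTo G c i) ≗ S → toℕ i ≡ m → Layer S c i
    top-layer {c} {i} class≗B upTo≗S i≡m = record
      { injective = headInjective-cong (sym ∘ class≗B) injective
      ; ranked = ranked-cong (sym ∘ class≗B) ranked
      ; heads = λ v → ⇔-trans (inHeadSet-⇔ class≗B)
                              (subst (λ t → InHeadSet G B v ⇔ (¬ v ≡ r × suc t ≤ indeg S v)) (sym i≡m) (top-heads v))
      ; cut = cutCondition-cong (sym ∘ upTo≗S) cut }

    lower-layer : ∀ {m′} {c : E → Fin (suc m)} {c′ : E → Fin m′} {i j} →
                  (S ∩ classOf G c i) ≗ ((S ∖ B) ∩ classOf G c′ j) → (S ∩ upTo G c i) ≗ ((S ∖ B) ∩ upTo G c′ j) →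
                  toℕ i ≡ toℕ j → toℕ j < m → Layer (S ∖ B) c′ j → Layer S c i
    lower-layer {i = i} {j} class≗ upTo≗ i≡j j<m layer = record
      { injective = headInjective-cong (sym ∘ class≗) L.injective
      ; ranked = ranked-cong (sym ∘ class≗) L.ranked
      ; heads = λ v → ⇔-trans (inHeadSet-⇔ class≗) (⇔-trans (L.heads v) (⇔-refl ×-⇔
          subst (λ t → suc (toℕ j) ≤ indeg (S ∖ B) v ⇔ suc t ≤ indeg S v) (sym i≡j) (threshold v j<m)))
      ; cut = cutCondition-cong (sym ∘ upTo≗) L.cut }
      where module L = Layer layer

    colour : (E → Fin m) → E → Fin (suc m)
    colour c′ e = Bool.if B e then fromℕ m else inject₁ (c′ e)

    stacked : ∀ {c′ : E → Fin m} → (∀ j → Layer (S ∖ B) c′ j) → ∀ i → Layer S (colour c′) i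
    stacked {c′} layers′ i with lastOrInject i
    ... | last = top-layer class-last upTo-last (toℕ-fromℕ m)
      where
      class-last : (S ∩ classOf G (colour c′) (fromℕ m)) ≗ B
      class-last e with B e in Be
      ... | true = cong₂ _∧_ (B⊆S e Be) (≟-refl (fromℕ m))
      ... | false = trans (cong (S e ∧_) (⌊⌋-false (inject₁ (c′ e) ≟ fromℕ m) (fromℕ≢inject₁ ∘ sym))) (∧-zeroʳ (S e))
      upTo-last : (S ∩ upTo G (colour c′) (fromℕ m)) ≗ S
      upTo-last e = trans (cong (S e ∧_) (⌊⌋-true (toℕ (colour c′ e) ℕ.≤? toℕ (fromℕ m))
        (subst (toℕ (colour c′ e) ≤_) (sym (toℕ-fromℕ m)) (toℕ≤pred[n] (colour c′ e))))) (∧-identityʳ (S e))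
    ... | inject j = lower-layer class-inject upTo-inject (toℕ-inject₁ j) (toℕ<n j) (layers′ j)
      where
      class-inject : (S ∩ classOf G (colour c′) (inject₁ j)) ≗ ((S ∖ B) ∩ classOf G c′ j)
      class-inject e with B e in Be
      ... | true = trans (trans (cong (S e ∧_) (⌊⌋-false (fromℕ m ≟ inject₁ j) fromℕ≢inject₁)) (∧-zeroʳ (S e)))
                         (sym (cong (_∧ ⌊ c′ e ≟ j ⌋) (∧-zeroʳ (S e))))
      ... | false = cong₂ _∧_ (sym (∧-identityʳ (S e))) (⌊inject₁≟inject₁⌋ (c′ e) j)
      upTo-inject : (S ∩ upTo G (colour c′) (inject₁ j)) ≗ ((S ∖ B) ∩ upTo G c′ j)
      upTo-inject e with B e in Be
      ... | true = trans (trans (cong (S e ∧_) (⌊⌋-false (toℕ (fromℕ m) ℕ.≤? toℕ (inject₁ j)) top-above))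
                                (∧-zeroʳ (S e)))
                         (sym (cong (_∧ ⌊ toℕ (c′ e) ℕ.≤? toℕ j ⌋) (∧-zeroʳ (S e))))
        where
        top-above : ¬ toℕ (fromℕ m) ≤ toℕ (inject₁ j)
        top-above le = <⇒≱ (toℕ<n j) (subst₂ _≤_ (toℕ-fromℕ m) (toℕ-inject₁ j) le)
      ... | false = cong₂ _∧_ (sym (∧-identityʳ (S e)))
                              (cong₂ (λ a b → ⌊ a ℕ.≤? b ⌋) (toℕ-inject₁ (c′ e)) (toℕ-inject₁ j))

  layers : ∀ m {S} → CutCondition S → indeg S r ≡ 0 → (∀ w → ¬ w ≡ r → indeg S w ≤ suc m) →
           ∃[ c ] (∀ (i : Fin (suc m)) → Layer S c i)
  layers zero {S} cut root-source indeg≤ = (λ _ → zero) , λ { zero → top-layer all-in-B (∧-identityʳ ∘ S) refl }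
    where
    open Peeled cut indeg≤
    rest-empty : ∀ e → (S ∖ B) e ≡ false
    rest-empty = no-edges λ w → case-root w
      where
      case-root : ∀ w → indeg (S ∖ B) w ≡ 0
      case-root w with w ≟ r
      ... | yes refl = rest-root root-source
      ... | no w≢r = n≤0⇒n≡0 (rest-indeg≤ w w≢r)
    all-in-B : (S ∩ classOf G {1} (λ _ → zero) zero) ≗ B
    all-in-B e with B e in Be
    ... | true = trans (∧-identityʳ (S e)) (B⊆S e Be)
    ... | false = trans (sym (cong (S e ∧_) (cong not Be))) (rest-empty e)
  layers (suc m) cut root-source indeg≤ = colour (proj₁ rest-layers) , stacked (proj₂ rest-layers)
    where
    open Peeled cut indeg≤
    rest-layers = layers m rest-cut (rest-root root-source) rest-indeg≤

theorem7 : (F : RootedDigraph) →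
    IsFlame F (allEdges F) →
    inDeg F (allEdges F) (root F) ≡ 0 →
    (m : ℕ) →
    ((v : Vertex F) → ¬ v ≡ root F → inDeg F (allEdges F) v ≤ m) →
    (∃[ v ] (¬ v ≡ root F × inDeg F (allEdges F) v ≡ m)) →
    1 ≤ m →
    ∃[ c ] ((i : Fin m) →
      IsBranching F (classOf F c i) ×
      ((v : Vertex F) → InHeadSet F (classOf F c i) v ⇔ (¬ v ≡ root F × suc (toℕ i) ≤ inDeg F (allEdges F) v)) ×
      IsFlame F (upTo F c i))
theorem7 F _ _ zero _ _ ()
theorem7 F flame root-source (suc m) inDeg≤ _ _ = c , λ i → let open Layer (proj₂ layering i) in
  ranked⇒branching injective ranked ,
  (λ v → subst (λ d → InHeadSet F (classOf F c i) v ⇔ (¬ v ≡ root F × suc (toℕ i) ≤ d))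
               (sym (inDeg≡indeg _ v)) (heads v)) ,
  cutCondition⇒flame cut
  where
  open Digraph F
  open Branching F using (ranked⇒branching)
  open Menger F using (cutCondition⇒flame)
  layering = layers F m (flame⇒cutCondition flame) (trans (sym (inDeg≡indeg _ r)) root-source)
                        (λ v v≢r → subst (_≤ suc m) (inDeg≡indeg _ v) (inDeg≤ v v≢r))
  c = proj₁ layering
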